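{- Let $\zeta$ be the zeta function of the poset $[\mathbf{2}]^*$ under composition order, and for $m\ge0$ let $\zeta^m$ be its $m$-th convolution power. Define rational functions $a_m(t),b_m(t)$ by $a_0(t)=b_0(t)=t$ and for $m\ge1$ $$a_m(t)=a_{m-1}(t)+b_{m-1}(t),\qquad b_m(t)=\frac{b_{m-1}(t)}{1-a_{m-1}(t)}.$$ If $u\in[\mathbf{2}]^*$ has type $t(u)=(l_1,l_2)$, then for all $m\ge0$ $$\sum_w\zeta^m(u,w)\,t^{\ell(w)}=a_m(t)^{l_1}b_m(t)^{l_2}\prod_{i=0}^{m-1}\frac{1}{1-a_i(t)-b_i(t)}$$ (sum over $w\in[\mathbf{2}]^*$). Furthermore, for all $m\ge0$, $$a_m(t)=\frac{t\,\bar a_m(t)}{d_m(t)},\qquad b_m(t)=\frac{t}{d_m(t)\,d_{m+1}(t)},$$ where $\bar a_m(t)=\sum_i(-1)^i\alpha_{m,i}t^i$ and $d_m(t)=\sum_i(-1)^i\delta_{m,i}t^i$ with $$\alpha_{m,i}=\begin{cases}\dfrac{(m+1)2^i}{2i+1}\dbinom{(m+2i)/2}{(m-2i)/2}&m\text{ even},\\[8pt] 2^{i+1}\dbinom{(m+2i+1)/2}{(m-2i-1)/2}&m\text{ odd},\end{cases}\qquad \delta_{m,i}=\begin{cases}\dfrac{m2^i}{m+2i}\dbinom{(m+2i)/2}{(m-2i)/2}&m\text{ even},\\[8pt] 2^{i}\dbinom{(m+2i-1)/2}{(m-2i-1)/2}&m\text{ odd},\end{cases}$$ where for $m=i=0$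 one sets $\delta_{0,0}=1$ (so $d_0(t)=1$).
   Context: Composition order: for words $u,w$ over positive integers, $u\le w$ iff there are indices $i_1<\cdots<i_l$ with $l=\ell(u)$ and $u(j)\le w(i_j)$ for all $j$; $[\mathbf{2}]^*$ is the poset of words with letters in $\{1,2\}$. $\zeta(u,w)=1$ if $u\le w$ and $0$ otherwise; convolution is $(\phi*\psi)(u,w)=\sum_v\phi(u,v)\psi(v,w)$ and $\zeta^0$ is the identity $\delta$. $\ell(w)$ is the length of $w$; the type $t(u)=(l_1,l_2)$ records the numbers of $1$'s and $2$'s in $u$. Binomial coefficient conventions: $\binom{n}{k}=0$ if $k<0$ or $k>n$, and $\binom{n}{0}=1$ for every $n$. -}

module Defs where

open import Data.Bool using (Bool; true; false; if_then_else_)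
open import Data.Nat as ℕ using (ℕ; zero; suc; _≡ᵇ_; _%_)
open import Data.Nat.Combinatorics using (_C_)
open import Data.Integer as ℤ using (ℤ; +_; -[1+_])
open import Data.Rational as ℚ using (ℚ; 0ℚ; 1ℚ; _+_; _*_; -_; _/_; 1/_; ≢-nonZero)
open import Data.Rational.Properties using (_≟_)
open import Data.List using (List; []; _∷_; map; concat; length; upTo; foldr)
open import Data.Nat.ListAction using (sum)
open import Data.List.Relation.Binary.Sublist.Heterogeneous using (Sublist)
open import Data.List.Relation.Binary.Sublist.Heterogeneous.Properties using (sublist?)
open import Data.List.Properties using (≡-dec)
open import Data.Product using (_×_; _,_; proj₁; proj₂)
open import Relation.Binary.PropositionalEquality using (_≡_; refl)
open import Relation.Nullary using (Dec; yes; no; does)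

data L2 : Set where
  ₁ ₂ : L2

data _≤L_ : L2 → L2 → Set where
  1≤1 : ₁ ≤L ₁
  1≤2 : ₁ ≤L ₂
  2≤2 : ₂ ≤L ₂

_≤L?_ : (x y : L2) → Dec (x ≤L y)
₁ ≤L? ₁ = yes 1≤1
₁ ≤L? ₂ = yes 1≤2
₂ ≤L? ₁ = no (λ ())
₂ ≤L? ₂ = yes 2≤2

_≟L_ : (x y : L2) → Dec (x ≡ y)
₁ ≟L ₁ = yes refl
₁ ≟L ₂ = no (λ ())
₂ ≟L ₁ = no (λ ())
₂ ≟L ₂ = yes refl

Word : Set
Word = List L2

-- Composition order: u ≤ w iff there are indices i₁<⋯<i_l (l = ℓ(u))
-- with u(j) ≤ w(i_j); i.e. u embeds into a subsequence of w letterwise.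
_≼_ : Word → Word → Set
u ≼ w = Sublist _≤L_ u w

ζ : Word → Word → ℕ
ζ u w = if does (sublist? _≤L?_ u w) then 1 else 0

δ : Word → Word → ℕ
δ u w = if does (≡-dec _≟L_ u w) then 1 else 0

wordsOfLength : ℕ → List Word
wordsOfLength zero    = [] ∷ []
wordsOfLength (suc n) = concat (map (λ w → (₁ ∷ w) ∷ (₂ ∷ w) ∷ []) (wordsOfLength n))

wordsUpTo : ℕ → List Word
wordsUpTo n = concat (map wordsOfLength (upTo (suc n)))

-- convolution powers: ζ^0 = δ, ζ^(m+1) = ζ^m * ζ.
-- (φ*ζ)(u,w) = Σ_v φ(u,v) ζ(v,w); terms vanish unless v ≤ w, which
-- forces ℓ(v) ≤ ℓ(w), so the sum is taken over words v with ℓ(v) ≤ ℓ(w).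
ζ^ : ℕ → Word → Word → ℕ
ζ^ zero    u w = δ u w
ζ^ (suc m) u w = sum (map (λ v → ζ^ m u v ℕ.* ζ v w) (wordsUpTo (length w)))

count : L2 → Word → ℕ
count x []      = 0
count x (y ∷ w) = (if does (x ≟L y) then 1 else 0) ℕ.+ count x w

type : Word → ℕ × ℕ
type u = count ₁ u , count ₂ u

PS : Set
PS = ℕ → ℚ

_≈ₚ_ : PS → PS → Set
f ≈ₚ g = ∀ n → f n ≡ g n

constP : ℚ → PS
constP c zero    = c
constP c (suc n) = 0ℚ

oneP : PS
oneP = constP 1ℚ

X : PS
X zero          = 0ℚ
X (suc zero)    = 1ℚ
X (suc (suc n)) = 0ℚ

_⊕_ : PS → PS → PS
(f ⊕ g) n = f n + g n

⊝_ : PS → PS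
(⊝ f) n = - f n

_⊖_ : PS → PS → PS
f ⊖ g = f ⊕ (⊝ g)

sumℚ : List ℚ → ℚ
sumℚ = foldr _+_ 0ℚ

_⊗_ : PS → PS → PS
(f ⊗ g) n = sumℚ (map (λ k → f k * g (n ℕ.∸ k)) (upTo (suc n)))

infixl 7 _⊗_
infixl 6 _⊕_ _⊖_

_^ₚ_ : PS → ℕ → PS
f ^ₚ zero  = oneP
f ^ₚ suc k = f ⊗ (f ^ₚ k)

prodP : ℕ → (ℕ → PS) → PS
prodP zero    f = oneP
prodP (suc m) f = prodP m f ⊗ f m

-- reciprocal in ℚ (only ever used on nonzero numbers; 0 ↦ 0 junk)
recip : ℚ → ℚ
recip p with p ≟ 0ℚ
... | yes _  = 0ℚ
... | no p≢0 = 1/_ p {{≢-nonZero p≢0}}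

-- multiplicative inverse of a power series with nonzero constant term:
-- g₀ = 1/f₀, g_n = -(1/f₀) Σ_{k=1}^{n} f_k g_{n-k}.
-- invCoeffs f n = [g_n, g_{n-1}, …, g_0]
private
  weighted : ℕ → List ℚ → PS → ℚ
  weighted j []       f = 0ℚ
  weighted j (x ∷ xs) f = f (suc j) * x + weighted (suc j) xs f

invCoeffs : PS → ℕ → List ℚ
invCoeffs f zero    = recip (f 0) ∷ []
invCoeffs f (suc n) = (- (recip (f 0) * weighted 0 gs f)) ∷ gs
  where gs = invCoeffs f n

invP : PS → PS
invP f n with invCoeffs f n
... | []    = 0ℚ
... | g ∷ _ = g

ab : ℕ → PS × PS
ab zero    = X , X
ab (suc m) = (proj₁ (ab m) ⊕ proj₂ (ab m)) , (proj₂ (ab m) ⊗ invP (oneP ⊖ proj₁ (ab m)))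

a : ℕ → PS
a m = proj₁ (ab m)

b : ℕ → PS
b m = proj₂ (ab m)

binomZ : ℕ → ℤ → ℕ
binomZ n (+ k)     = n C k
binomZ n -[1+ _ ]  = 0

isEven : ℕ → Bool
isEven m = m % 2 ≡ᵇ 0

lowE : ℕ → ℕ → ℤ
lowE m i = + (m ℕ./ 2) ℤ.- + i

lowO : ℕ → ℕ → ℤ
lowO m i = + ((m ℕ.∸ 1) ℕ./ 2) ℤ.- + i

αc : ℕ → ℕ → ℚ
αc m i = if isEven m
  then ((+ ((m ℕ.+ 1) ℕ.* (2 ℕ.^ i))) / suc (2 ℕ.* i))
         * ((+ binomZ ((m ℕ.+ 2 ℕ.* i) ℕ./ 2) (lowE m i)) / 1)
  else (+ ((2 ℕ.^ (i ℕ.+ 1)) ℕ.* binomZ ((m ℕ.+ 2 ℕ.* i ℕ.+ 1) ℕ./ 2) (lowO m i))) / 1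

δc : ℕ → ℕ → ℚ
δc zero zero = 1ℚ
δc zero (suc i) =
  ((+ 0) / (2 ℕ.* suc i ℕ.+ 0)) * ((+ binomZ ((2 ℕ.* suc i) ℕ./ 2) (lowE 0 (suc i))) / 1)
δc (suc k) i = if isEven (suc k)
  then ((+ (suc k ℕ.* (2 ℕ.^ i))) / (suc k ℕ.+ 2 ℕ.* i))
         * ((+ binomZ ((suc k ℕ.+ 2 ℕ.* i) ℕ./ 2) (lowE (suc k) i)) / 1)
  else (+ ((2 ℕ.^ i) ℕ.* binomZ ((suc k ℕ.+ 2 ℕ.* i ℕ.∸ 1) ℕ./ 2) (lowO (suc k) i))) / 1

sgn : ℕ → ℚ
sgn zero    = 1ℚ
sgn (suc i) = - sgn i

abar : ℕ → PS
abar m i = sgn i * αc m i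

d : ℕ → PS
d m i = sgn i * δc m i

genZ : ℕ → Word → PS
genZ m u n = (+ sum (map (λ w → ζ^ m u w) (wordsOfLength n))) / 1

{-# OPTIONS --safe #-}
module Submission where

-- Weight a word w by x^{#₁w} y^{#₂w}, for power series x, y without constant term,
-- and put L(v) = Σ_w ζ(v,w) x^{#₁w} y^{#₂w}. Since ζ(1v,cw) = ζ(v,w) for either
-- letter c, ζ(2v,1w) = ζ(2v,w) and ζ(2v,2w) = ζ(v,w), splitting off the first letter
-- of w gives L(1v) = (x + y) L(v), L(2v) = x L(2v) + y L(v), L([]) = 1 + (x + y) L([]),
-- so L(v) = x′^{#₁v} y′^{#₂v} / (1 - x - y) with x′ = x + y and y′ = y / (1 - x).
-- As ζ^{m+1}(u,w) = Σ_v ζ^m(u,v) ζ(v,w), summing over w first turns the weights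
-- (x, y) into (x′, y′) at the cost of a factor 1 / (1 - x - y); starting from (t, t),
-- the m-th iterate is (a_m, b_m).
--
-- For the closed forms, the binomial formulas for α and δ give t ā_m = d_m - d_{m+2}
-- and d_{m+4} + d_m = 2(1 - t) d_{m+2}. The latter makes d_{m+2} d_{m+1} - d_{m+3} d_m
-- invariant under m ↦ m + 2, so it equals its initial value t, and this identity is
-- exactly what the recursions for a_m and b_m need.

module NatCast where

  open import Data.Nat as ℕ using (ℕ; suc)
  open import Data.Integer as ℤ using (+_)
  import Data.Integer.Properties as ℤ
  import Data.Nat.Properties as ℕ
  open import Data.List using (List; []; _∷_; map)
  open import Data.Nat.ListAction as ℕ using ()
  open import Data.Rational using (ℚ; _+_; _*_; _/_; toℚᵘ)
  open import Data.Rational.Properties using (toℚᵘ-injective; toℚᵘ-fromℚᵘ; toℚᵘ-homo-+; toℚᵘ-homo-*)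
  open import Data.Rational.Unnormalised as ℚᵘ using (mkℚᵘ; *≡*)
  import Data.Rational.Unnormalised.Properties as ℚᵘ
  open import Function using (_∘_)
  open import Relation.Binary.PropositionalEquality using (_≡_; refl; sym; cong; cong₂; trans; module ≡-Reasoning)
  open import Data.Integer.Solver using (module +-*-Solver)
  open +-*-Solver

  open import Defs using (sumℚ)

  ι : ℕ → ℚ
  ι n = + n / 1

  toℚᵘ-ι : ∀ n → toℚᵘ (ι n) ℚᵘ.≃ mkℚᵘ (+ n) 0
  toℚᵘ-ι n = toℚᵘ-fromℚᵘ (mkℚᵘ (+ n) 0)

  ι-+ : ∀ m n → ι (m ℕ.+ n) ≡ ι m + ι n
  ι-+ m n = toℚᵘ-injective (begin
    toℚᵘ (ι (m ℕ.+ n))              ≈⟨ toℚᵘ-ι (m ℕ.+ n) ⟩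
    mkℚᵘ (+ (m ℕ.+ n)) 0            ≈⟨ *≡* (solve 2 (λ m n → (m :+ n) :* con (+ 1) := (m :* con (+ 1) :+ n :* con (+ 1)) :* con (+ 1)) refl (+ m) (+ n)) ⟩
    mkℚᵘ (+ m) 0 ℚᵘ.+ mkℚᵘ (+ n) 0  ≈⟨ ℚᵘ.≃-sym (ℚᵘ.+-cong (toℚᵘ-ι m) (toℚᵘ-ι n)) ⟩
    toℚᵘ (ι m) ℚᵘ.+ toℚᵘ (ι n)      ≈⟨ ℚᵘ.≃-sym (toℚᵘ-homo-+ (ι m) (ι n)) ⟩
    toℚᵘ (ι m + ι n)                ∎)
    where open ℚᵘ.≃-Reasoning

  ι-* : ∀ m n → ι (m ℕ.* n) ≡ ι m * ι n
  ι-* m n = toℚᵘ-injective (begin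
    toℚᵘ (ι (m ℕ.* n))              ≈⟨ toℚᵘ-ι (m ℕ.* n) ⟩
    mkℚᵘ (+ (m ℕ.* n)) 0            ≈⟨ *≡* (cong (ℤ._* + 1) (ℤ.pos-* m n)) ⟩
    mkℚᵘ (+ m) 0 ℚᵘ.* mkℚᵘ (+ n) 0  ≈⟨ ℚᵘ.≃-sym (ℚᵘ.*-cong (toℚᵘ-ι m) (toℚᵘ-ι n)) ⟩
    toℚᵘ (ι m) ℚᵘ.* toℚᵘ (ι n)      ≈⟨ ℚᵘ.≃-sym (toℚᵘ-homo-* (ι m) (ι n)) ⟩
    toℚᵘ (ι m * ι n)                ∎)
    where open ℚᵘ.≃-Reasoning

  ι-sum : ∀ {A : Set} (f : A → ℕ) (xs : List A) → ι (ℕ.sum (map f xs)) ≡ sumℚ (map (ι ∘ f) xs)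
  ι-sum f []       = refl
  ι-sum f (x ∷ xs) = trans (ι-+ (f x) (ℕ.sum (map f xs))) (cong (λ r → ι (f x) + r) (ι-sum f xs))

  cross-multiply : ∀ x q c y → q ℕ.* y ≡ x ℕ.* c → (+ x ℤ.* + c) ℤ.* + 1 ≡ + y ℤ.* + (q ℕ.* 1)
  cross-multiply x q c y qy≡xc = begin
    (+ x ℤ.* + c) ℤ.* + 1  ≡⟨ ℤ.*-identityʳ _ ⟩
    + x ℤ.* + c            ≡⟨ ℤ.pos-* x c ⟨
    + (x ℕ.* c)            ≡⟨ cong +_ (sym qy≡xc) ⟩
    + (q ℕ.* y)            ≡⟨ cong +_ (ℕ.*-comm q y) ⟩
    + (y ℕ.* q)            ≡⟨ ℤ.pos-* y q ⟩
    + y ℤ.* + q            ≡⟨ cong (λ r → + y ℤ.* + r) (ℕ.*-identityʳ q) ⟨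
    + y ℤ.* + (q ℕ.* 1)    ∎
    where open ≡-Reasoning

  /-*-ι : ∀ x q c y .{{_ : ℕ.NonZero q}} → q ℕ.* y ≡ x ℕ.* c → (+ x / q) * ι c ≡ ι y
  /-*-ι x q@(suc q-1) c y qy≡xc = toℚᵘ-injective (begin
    toℚᵘ (+ x / q * ι c)              ≈⟨ toℚᵘ-homo-* (+ x / q) (ι c) ⟩
    toℚᵘ (+ x / q) ℚᵘ.* toℚᵘ (ι c)    ≈⟨ ℚᵘ.*-cong (toℚᵘ-fromℚᵘ (mkℚᵘ (+ x) q-1)) (toℚᵘ-ι c) ⟩
    mkℚᵘ (+ x) q-1 ℚᵘ.* mkℚᵘ (+ c) 0  ≈⟨ *≡* (cross-multiply x q c y qy≡xc) ⟩
    mkℚᵘ (+ y) 0                      ≈⟨ ℚᵘ.≃-sym (toℚᵘ-ι y) ⟩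
    toℚᵘ (ι y)                        ∎)
    where open ℚᵘ.≃-Reasoning

  ι-step : ∀ a b c {x y z} → x ≡ ι a → y ≡ ι b → z ≡ ι c → a ℕ.+ b ≡ c → x + y ≡ z
  ι-step a b c {x} {y} {z} x≡ y≡ z≡ a+b≡c = begin
    x + y        ≡⟨ cong₂ _+_ x≡ y≡ ⟩
    ι a + ι b    ≡⟨ ι-+ a b ⟨
    ι (a ℕ.+ b)  ≡⟨ cong ι a+b≡c ⟩
    ι c          ≡⟨ z≡ ⟨
    z            ∎
    where open ≡-Reasoning

  ι-recurrence : ∀ a b c d {w x y z} → w ≡ ι a → x ≡ ι b → y ≡ ι c → z ≡ ι d →
                 a ℕ.+ b ≡ 2 ℕ.* c ℕ.+ 2 ℕ.* d → w + x ≡ ι 2 * y + ι 2 * z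
  ι-recurrence a b c d {w} {x} {y} {z} w≡ x≡ y≡ z≡ a+b≡ = begin
    w + x                      ≡⟨ cong₂ _+_ w≡ x≡ ⟩
    ι a + ι b                  ≡⟨ ι-+ a b ⟨
    ι (a ℕ.+ b)                ≡⟨ cong ι a+b≡ ⟩
    ι (2 ℕ.* c ℕ.+ 2 ℕ.* d)    ≡⟨ ι-+ (2 ℕ.* c) (2 ℕ.* d) ⟩
    ι (2 ℕ.* c) + ι (2 ℕ.* d)  ≡⟨ cong₂ _+_ (ι-* 2 c) (ι-* 2 d) ⟩
    ι 2 * ι c + ι 2 * ι d      ≡⟨ cong₂ (λ u v → ι 2 * u + ι 2 * v) y≡ z≡ ⟨
    ι 2 * y + ι 2 * z          ∎
    where open ≡-Reasoning

module PowerSeries where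

  open import Data.Nat as ℕ using (ℕ; zero; suc; _<_; z≤n; s≤s)
  import Data.Nat.Properties as ℕ
  open import Data.List using (List; _∷_)
  open import Data.List.Properties using (map-applyUpTo)
  open import Data.Maybe using (Maybe; just; nothing)
  open import Data.Product using (_,_)
  open import Data.Rational using (ℚ; 0ℚ; 1ℚ; _+_; _*_; -_; _-_; ≢-nonZero)
  open import Data.Rational.Properties
  open import Data.Rational.Solver using (module +-*-Solver)
  open import Function using (id)
  open import Relation.Binary.Bundles using (Setoid)
  open import Relation.Binary.Structures using (IsEquivalence)
  open import Relation.Binary.PropositionalEquality
  open import Relation.Nullary using (yes; no)
  open import Relation.Nullary.Negation using (contradiction)
  open import Algebra.Bundles using (CommutativeRing)
  open import Algebra.Structures using (IsCommutativeRing)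
  open import Algebra.Solver.Ring.AlmostCommutativeRing
    using (fromCommutativeRing; _-Raw-AlmostCommutative⟶_)
  import Algebra.Solver.Ring as RingSolver
  import Relation.Binary.Reasoning.Setoid as SetoidReasoning
  open import Algebra.Bundles using (CommutativeMonoid)
  open import Algebra.Properties.CommutativeSemigroup (CommutativeMonoid.commutativeSemigroup +-0-commutativeMonoid)
    using () renaming (interchange to +-interchange)

  open import Defs using (PS; _≈ₚ_; constP; oneP; X; _⊕_; ⊝_; _⊖_; _⊗_; prodP; sumℚ; recip; invCoeffs; invP)

  -- `f ≈ₚ g` unfolds to a Π-type, from which Agda cannot recover `f` and `g`;
  -- wrapping it in a record makes both sides inferable.
  infix 4 _≐_
  record _≐_ (f g : PS) : Set where
    constructor coeffwise
    field coeff : f ≈ₚ g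
  open _≐_ public

  ≐-refl : ∀ {f} → f ≐ f
  ≐-refl .coeff n = refl

  ≐-sym : ∀ {f g} → f ≐ g → g ≐ f
  ≐-sym p .coeff n = sym (p .coeff n)

  ≐-trans : ∀ {f g h} → f ≐ g → g ≐ h → f ≐ h
  ≐-trans p q .coeff n = trans (p .coeff n) (q .coeff n)

  ≐-isEquivalence : IsEquivalence _≐_
  ≐-isEquivalence = record { refl = ≐-refl ; sym = ≐-sym ; trans = ≐-trans }

  ≐-setoid : Setoid _ _
  ≐-setoid = record { isEquivalence = ≐-isEquivalence }

  module ≐-Reasoning = SetoidReasoning ≐-setoid

  ≡⇒≐ : ∀ {f g} → f ≡ g → f ≐ g
  ≡⇒≐ refl = ≐-refl

  shift : PS → PS
  shift f n = f (suc n)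

  shift-cong : ∀ {f g} → f ≐ g → shift f ≐ shift g
  shift-cong p .coeff n = p .coeff (suc n)

  infixr 8 _·_
  _·_ : ℚ → PS → PS
  (c · f) n = c * f n

  ⊕-cong : ∀ {f f′ g g′} → f ≐ f′ → g ≐ g′ → f ⊕ g ≐ f′ ⊕ g′
  ⊕-cong p q .coeff n = cong₂ _+_ (p .coeff n) (q .coeff n)

  ⊕-congˡ : ∀ h {g g′} → g ≐ g′ → h ⊕ g ≐ h ⊕ g′
  ⊕-congˡ h = ⊕-cong (≐-refl {h})

  ⊕-congʳ : ∀ h {f f′} → f ≐ f′ → f ⊕ h ≐ f′ ⊕ h
  ⊕-congʳ h p = ⊕-cong p (≐-refl {h})

  ⊝-cong : ∀ {f f′} → f ≐ f′ → ⊝ f ≐ ⊝ f′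
  ⊝-cong p .coeff n = cong -_ (p .coeff n)

  ⊖-cong : ∀ {f f′ g g′} → f ≐ f′ → g ≐ g′ → f ⊖ g ≐ f′ ⊖ g′
  ⊖-cong p q = ⊕-cong p (⊝-cong q)

  ⊖-congˡ : ∀ h {g g′} → g ≐ g′ → h ⊖ g ≐ h ⊖ g′
  ⊖-congˡ h p = ⊕-congˡ h (⊝-cong p)

  ⊖-congʳ : ∀ h {f f′} → f ≐ f′ → f ⊖ h ≐ f′ ⊖ h
  ⊖-congʳ h = ⊕-congʳ (⊝ h)

  ⊗-at-zero : ∀ f g → (f ⊗ g) 0 ≡ f 0 * g 0
  ⊗-at-zero f g = +-identityʳ (f 0 * g 0)

  ⊗-at-suc : ∀ f g n → (f ⊗ g) (suc n) ≡ f 0 * g (suc n) + (shift f ⊗ g) n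
  ⊗-at-suc f g n = cong (λ s → f 0 * g (suc n) + sumℚ s)
    (trans (map-applyUpTo suc (λ k → f k * g (suc n ℕ.∸ k)) (suc n))
           (sym (map-applyUpTo id (λ k → f (suc k) * g (n ℕ.∸ k)) (suc n))))

  ⊗-at-sucʳ : ∀ f g n → (f ⊗ g) (suc n) ≡ (f ⊗ shift g) n + f (suc n) * g 0
  ⊗-at-sucʳ f g zero = begin
    f 0 * g 1 + (shift f ⊗ g) 0  ≡⟨ cong (f 0 * g 1 +_) (⊗-at-zero (shift f) g) ⟩
    f 0 * g 1 + f 1 * g 0        ≡⟨ cong (_+ f 1 * g 0) (⊗-at-zero f (shift g)) ⟨
    (f ⊗ shift g) 0 + f 1 * g 0  ∎
    where open ≡-Reasoning
  ⊗-at-sucʳ f g (suc n) = begin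
    (f ⊗ g) (2 ℕ.+ n)                                                ≡⟨ ⊗-at-suc f g (suc n) ⟩
    f 0 * g (2 ℕ.+ n) + (shift f ⊗ g) (suc n)                        ≡⟨ cong (f 0 * g (2 ℕ.+ n) +_) (⊗-at-sucʳ (shift f) g n) ⟩
    f 0 * g (2 ℕ.+ n) + ((shift f ⊗ shift g) n + f (2 ℕ.+ n) * g 0)  ≡⟨ +-assoc (f 0 * g (2 ℕ.+ n)) _ (f (2 ℕ.+ n) * g 0) ⟨
    f 0 * g (2 ℕ.+ n) + (shift f ⊗ shift g) n + f (2 ℕ.+ n) * g 0    ≡⟨ cong (_+ f (2 ℕ.+ n) * g 0) (⊗-at-suc f (shift g) n) ⟨
    (f ⊗ shift g) (suc n) + f (2 ℕ.+ n) * g 0                        ∎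
    where open ≡-Reasoning

  ⊗-cong : ∀ {f f′ g g′} → f ≐ f′ → g ≐ g′ → f ⊗ g ≐ f′ ⊗ g′
  ⊗-cong {f} {f′} {g} {g′} p q .coeff zero = begin
    (f ⊗ g) 0    ≡⟨ ⊗-at-zero f g ⟩
    f 0 * g 0    ≡⟨ cong₂ _*_ (p .coeff 0) (q .coeff 0) ⟩
    f′ 0 * g′ 0  ≡⟨ ⊗-at-zero f′ g′ ⟨
    (f′ ⊗ g′) 0  ∎
    where open ≡-Reasoning
  ⊗-cong {f} {f′} {g} {g′} p q .coeff (suc n) = begin
    (f ⊗ g) (suc n)                    ≡⟨ ⊗-at-suc f g n ⟩
    f 0 * g (suc n) + (shift f ⊗ g) n  ≡⟨ cong₂ _+_ (cong₂ _*_ (p .coeff 0) (q .coeff (suc n)))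
                                                           (⊗-cong (shift-cong p) q .coeff n) ⟩
    f′ 0 * g′ (suc n) + (shift f′ ⊗ g′) n  ≡⟨ ⊗-at-suc f′ g′ n ⟨
    (f′ ⊗ g′) (suc n)                      ∎
    where open ≡-Reasoning

  ⊗-congˡ : ∀ h {g g′} → g ≐ g′ → h ⊗ g ≐ h ⊗ g′
  ⊗-congˡ h = ⊗-cong (≐-refl {h})

  ⊗-congʳ : ∀ h {f f′} → f ≐ f′ → f ⊗ h ≐ f′ ⊗ h
  ⊗-congʳ h p = ⊗-cong p (≐-refl {h})

  ⊗-comm : ∀ f g → f ⊗ g ≐ g ⊗ f
  ⊗-comm f g .coeff zero = trans (⊗-at-zero f g) (trans (*-comm (f 0) (g 0)) (sym (⊗-at-zero g f)))
  ⊗-comm f g .coeff (suc n) = begin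
    (f ⊗ g) (suc n)                    ≡⟨ ⊗-at-suc f g n ⟩
    f 0 * g (suc n) + (shift f ⊗ g) n  ≡⟨ cong (f 0 * g (suc n) +_) (⊗-comm (shift f) g .coeff n) ⟩
    f 0 * g (suc n) + (g ⊗ shift f) n  ≡⟨ +-comm (f 0 * g (suc n)) _ ⟩
    (g ⊗ shift f) n + f 0 * g (suc n)  ≡⟨ cong ((g ⊗ shift f) n +_) (*-comm (f 0) (g (suc n))) ⟩
    (g ⊗ shift f) n + g (suc n) * f 0  ≡⟨ ⊗-at-sucʳ g f n ⟨
    (g ⊗ f) (suc n)                    ∎
    where open ≡-Reasoning

  ⊗-distribʳ : ∀ h f g → (f ⊕ g) ⊗ h ≐ (f ⊗ h) ⊕ (g ⊗ h)
  ⊗-distribʳ h f g .coeff zero = begin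
    ((f ⊕ g) ⊗ h) 0        ≡⟨ ⊗-at-zero (f ⊕ g) h ⟩
    (f 0 + g 0) * h 0      ≡⟨ *-distribʳ-+ (h 0) (f 0) (g 0) ⟩
    f 0 * h 0 + g 0 * h 0  ≡⟨ cong₂ _+_ (⊗-at-zero f h) (⊗-at-zero g h) ⟨
    (f ⊗ h) 0 + (g ⊗ h) 0  ∎
    where open ≡-Reasoning
  ⊗-distribʳ h f g .coeff (suc n) = begin
    ((f ⊕ g) ⊗ h) (suc n)
      ≡⟨ ⊗-at-suc (f ⊕ g) h n ⟩
    (f 0 + g 0) * h (suc n) + ((shift f ⊕ shift g) ⊗ h) n
      ≡⟨ cong₂ _+_ (*-distribʳ-+ (h (suc n)) (f 0) (g 0)) (⊗-distribʳ h (shift f) (shift g) .coeff n) ⟩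
    (f 0 * h (suc n) + g 0 * h (suc n)) + ((shift f ⊗ h) n + (shift g ⊗ h) n)
      ≡⟨ +-interchange (f 0 * h (suc n)) _ _ _ ⟩
    (f 0 * h (suc n) + (shift f ⊗ h) n) + (g 0 * h (suc n) + (shift g ⊗ h) n)
      ≡⟨ cong₂ _+_ (⊗-at-suc f h n) (⊗-at-suc g h n) ⟨
    (f ⊗ h) (suc n) + (g ⊗ h) (suc n)
      ∎
    where open ≡-Reasoning

  ·-⊗ : ∀ c f g → (c · f) ⊗ g ≐ c · (f ⊗ g)
  ·-⊗ c f g .coeff zero = begin
    ((c · f) ⊗ g) 0  ≡⟨ ⊗-at-zero (c · f) g ⟩
    c * f 0 * g 0    ≡⟨ *-assoc c (f 0) (g 0) ⟩
    c * (f 0 * g 0)  ≡⟨ cong (c *_) (⊗-at-zero f g) ⟨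
    c * (f ⊗ g) 0    ∎
    where open ≡-Reasoning
  ·-⊗ c f g .coeff (suc n) = begin
    ((c · f) ⊗ g) (suc n)                        ≡⟨ ⊗-at-suc (c · f) g n ⟩
    c * f 0 * g (suc n) + ((c · shift f) ⊗ g) n  ≡⟨ cong₂ _+_ (*-assoc c (f 0) (g (suc n))) (·-⊗ c (shift f) g .coeff n) ⟩
    c * (f 0 * g (suc n)) + c * (shift f ⊗ g) n  ≡⟨ *-distribˡ-+ c _ _ ⟨
    c * (f 0 * g (suc n) + (shift f ⊗ g) n)      ≡⟨ cong (c *_) (⊗-at-suc f g n) ⟨
    c * (f ⊗ g) (suc n)                          ∎
    where open ≡-Reasoning

  ·-cong : ∀ c {f g} → f ≐ g → c · f ≐ c · g
  ·-cong c p .coeff n = cong (c *_) (p .coeff n)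

  ⊗-· : ∀ c f g → f ⊗ (c · g) ≐ c · (f ⊗ g)
  ⊗-· c f g = begin
    f ⊗ (c · g)  ≈⟨ ⊗-comm f (c · g) ⟩
    (c · g) ⊗ f  ≈⟨ ·-⊗ c g f ⟩
    c · (g ⊗ f)  ≈⟨ ·-cong c (⊗-comm g f) ⟩
    c · (f ⊗ g)  ∎
    where open ≐-Reasoning

  ·-identityˡ : ∀ f → 1ℚ · f ≐ f
  ·-identityˡ f .coeff n = *-identityˡ (f n)

  ·-zeroˡ : ∀ f → 0ℚ · f ≐ constP 0ℚ
  ·-zeroˡ f .coeff zero    = *-zeroˡ (f 0)
  ·-zeroˡ f .coeff (suc n) = *-zeroˡ (f (suc n))

  constant-series : ∀ {f} c → f 0 ≡ c → (∀ i → f (suc i) ≡ 0ℚ) → f ≐ constP c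
  constant-series c f₀≡c f₊≡0 .coeff zero    = f₀≡c
  constant-series c f₀≡c f₊≡0 .coeff (suc i) = f₊≡0 i

  constP-⊗ : ∀ c g → constP c ⊗ g ≐ c · g
  constP-⊗ c g .coeff zero = ⊗-at-zero (constP c) g
  constP-⊗ c g .coeff (suc n) = begin
    (constP c ⊗ g) (suc n)                           ≡⟨ ⊗-at-suc (constP c) g n ⟩
    c * g (suc n) + (shift (constP c) ⊗ g) n         ≡⟨ cong (c * g (suc n) +_) (⊗-cong shift-constP (≐-refl {g}) .coeff n) ⟩
    c * g (suc n) + ((0ℚ · shift (constP c)) ⊗ g) n  ≡⟨ cong (c * g (suc n) +_) (·-⊗ 0ℚ (shift (constP c)) g .coeff n) ⟩
    c * g (suc n) + 0ℚ * (shift (constP c) ⊗ g) n    ≡⟨ cong (c * g (suc n) +_) (*-zeroˡ ((shift (constP c) ⊗ g) n)) ⟩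
    c * g (suc n) + 0ℚ                               ≡⟨ +-identityʳ _ ⟩
    c * g (suc n)                                    ∎
    where
    open ≡-Reasoning
    shift-constP : shift (constP c) ≐ 0ℚ · shift (constP c)
    shift-constP .coeff n = sym (*-zeroˡ 0ℚ)

  ⊗-identityˡ : ∀ g → oneP ⊗ g ≐ g
  ⊗-identityˡ g = ≐-trans (constP-⊗ 1ℚ g) (coeffwise λ n → *-identityˡ (g n))

  ⊗-assoc : ∀ f g h → (f ⊗ g) ⊗ h ≐ f ⊗ (g ⊗ h)
  ⊗-assoc f g h .coeff zero = begin
    ((f ⊗ g) ⊗ h) 0    ≡⟨ ⊗-at-zero (f ⊗ g) h ⟩
    (f ⊗ g) 0 * h 0    ≡⟨ cong (_* h 0) (⊗-at-zero f g) ⟩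
    f 0 * g 0 * h 0    ≡⟨ *-assoc (f 0) (g 0) (h 0) ⟩
    f 0 * (g 0 * h 0)  ≡⟨ cong (f 0 *_) (⊗-at-zero g h) ⟨
    f 0 * (g ⊗ h) 0    ≡⟨ ⊗-at-zero f (g ⊗ h) ⟨
    (f ⊗ (g ⊗ h)) 0    ∎
    where open ≡-Reasoning
  ⊗-assoc f g h .coeff (suc n) = begin
    ((f ⊗ g) ⊗ h) (suc n)
      ≡⟨ ⊗-at-suc (f ⊗ g) h n ⟩
    (f ⊗ g) 0 * h (suc n) + (shift (f ⊗ g) ⊗ h) n
      ≡⟨ cong₂ _+_ (cong (_* h (suc n)) (⊗-at-zero f g)) (⊗-cong shift-⊗ (≐-refl {h}) .coeff n) ⟩
    f 0 * g 0 * h (suc n) + (((f 0 · shift g) ⊕ (shift f ⊗ g)) ⊗ h) n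
      ≡⟨ cong (f 0 * g 0 * h (suc n) +_) (⊗-distribʳ h (f 0 · shift g) (shift f ⊗ g) .coeff n) ⟩
    f 0 * g 0 * h (suc n) + (((f 0 · shift g) ⊗ h) n + ((shift f ⊗ g) ⊗ h) n)
      ≡⟨ cong (f 0 * g 0 * h (suc n) +_) (cong₂ _+_ (·-⊗ (f 0) (shift g) h .coeff n) (⊗-assoc (shift f) g h .coeff n)) ⟩
    f 0 * g 0 * h (suc n) + (f 0 * (shift g ⊗ h) n + (shift f ⊗ (g ⊗ h)) n)
      ≡⟨ regroup (f 0) (g 0) (h (suc n)) ((shift g ⊗ h) n) ((shift f ⊗ (g ⊗ h)) n) ⟩
    f 0 * (g 0 * h (suc n) + (shift g ⊗ h) n) + (shift f ⊗ (g ⊗ h)) n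
      ≡⟨ cong (λ s → f 0 * s + (shift f ⊗ (g ⊗ h)) n) (⊗-at-suc g h n) ⟨
    f 0 * (g ⊗ h) (suc n) + (shift f ⊗ (g ⊗ h)) n
      ≡⟨ ⊗-at-suc f (g ⊗ h) n ⟨
    (f ⊗ (g ⊗ h)) (suc n)
      ∎
    where
    open ≡-Reasoning
    open +-*-Solver
    shift-⊗ : shift (f ⊗ g) ≐ (f 0 · shift g) ⊕ (shift f ⊗ g)
    shift-⊗ .coeff = ⊗-at-suc f g
    regroup : ∀ a b c d e → a * b * c + (a * d + e) ≡ a * (b * c + d) + e
    regroup = solve 5 (λ a b c d e → a :* b :* c :+ (a :* d :+ e) := a :* (b :* c :+ d) :+ e) refl

  ⊗-identityʳ : ∀ g → g ⊗ oneP ≐ g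
  ⊗-identityʳ g = ≐-trans (⊗-comm g oneP) (⊗-identityˡ g)

  ⊗-distribˡ : ∀ h f g → h ⊗ (f ⊕ g) ≐ (h ⊗ f) ⊕ (h ⊗ g)
  ⊗-distribˡ h f g = begin
    h ⊗ (f ⊕ g)        ≈⟨ ⊗-comm h (f ⊕ g) ⟩
    (f ⊕ g) ⊗ h        ≈⟨ ⊗-distribʳ h f g ⟩
    (f ⊗ h) ⊕ (g ⊗ h)  ≈⟨ ⊕-cong (⊗-comm f h) (⊗-comm g h) ⟩
    (h ⊗ f) ⊕ (h ⊗ g)  ∎
    where open ≐-Reasoning

  PS-isCommutativeRing : IsCommutativeRing _≐_ _⊕_ _⊗_ ⊝_ (constP 0ℚ) oneP
  PS-isCommutativeRing = record
    { isRing = record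
      { +-isAbelianGroup = record
        { isGroup = record
          { isMonoid = record
            { isSemigroup = record
              { isMagma = record { isEquivalence = ≐-isEquivalence ; ∙-cong = ⊕-cong }
              ; assoc = λ f g h → coeffwise λ n → +-assoc (f n) (g n) (h n) }
            ; identity = (λ f → coeffwise (zero-+ f)) , (λ f → coeffwise (+-zero f)) }
          ; inverse = (λ f → coeffwise (⊝-+ f)) , (λ f → coeffwise (+-⊝ f))
          ; ⁻¹-cong = ⊝-cong }
        ; comm = λ f g → coeffwise λ n → +-comm (f n) (g n) }
      ; *-cong = ⊗-cong
      ; *-assoc = ⊗-assoc
      ; *-identity = ⊗-identityˡ , ⊗-identityʳ
      ; distrib = ⊗-distribˡ , ⊗-distribʳ }
    ; *-comm = ⊗-comm }
    where
    zero-+ : ∀ f → (constP 0ℚ ⊕ f) ≈ₚ f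
    zero-+ f zero    = +-identityˡ (f 0)
    zero-+ f (suc n) = +-identityˡ (f (suc n))
    +-zero : ∀ f → (f ⊕ constP 0ℚ) ≈ₚ f
    +-zero f zero    = +-identityʳ (f 0)
    +-zero f (suc n) = +-identityʳ (f (suc n))
    ⊝-+ : ∀ f → ((⊝ f) ⊕ f) ≈ₚ constP 0ℚ
    ⊝-+ f zero    = +-inverseˡ (f 0)
    ⊝-+ f (suc n) = +-inverseˡ (f (suc n))
    +-⊝ : ∀ f → (f ⊕ (⊝ f)) ≈ₚ constP 0ℚ
    +-⊝ f zero    = +-inverseʳ (f 0)
    +-⊝ f (suc n) = +-inverseʳ (f (suc n))

  PS-commutativeRing : CommutativeRing _ _
  PS-commutativeRing = record { isCommutativeRing = PS-isCommutativeRing }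

  constP-homomorphism : +-*-rawRing -Raw-AlmostCommutative⟶ fromCommutativeRing PS-commutativeRing
  constP-homomorphism = record
    { ⟦_⟧    = constP
    ; +-homo = λ a b → coeffwise λ { zero → refl ; (suc n) → sym (+-identityˡ 0ℚ) }
    ; *-homo = λ a b → ≐-sym (≐-trans (constP-⊗ a (constP b)) (coeffwise λ { zero → refl ; (suc n) → *-zeroʳ a }))
    ; -‿homo = λ a → coeffwise λ { zero → refl ; (suc n) → refl }
    ; 0-homo = ≐-refl
    ; 1-homo = ≐-refl }

  constP-≟ : ∀ a b → Maybe (constP a ≐ constP b)
  constP-≟ a b with a ≟ b
  ... | yes refl = just ≐-refl
  ... | no _     = nothing

  module PS-Solver = RingSolver +-*-rawRing (fromCommutativeRing PS-commutativeRing) constP-homomorphism constP-≟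

  X⊗-at-zero : ∀ f → (X ⊗ f) 0 ≡ 0ℚ
  X⊗-at-zero f = trans (⊗-at-zero X f) (*-zeroˡ (f 0))

  X⊗-at-suc : ∀ f n → (X ⊗ f) (suc n) ≡ f n
  X⊗-at-suc f n = begin
    (X ⊗ f) (suc n)                   ≡⟨ ⊗-at-suc X f n ⟩
    0ℚ * f (suc n) + (shift X ⊗ f) n  ≡⟨ cong₂ _+_ (*-zeroˡ (f (suc n))) (⊗-cong shift-X (≐-refl {f}) .coeff n) ⟩
    0ℚ + (oneP ⊗ f) n                 ≡⟨ +-identityˡ _ ⟩
    (oneP ⊗ f) n                      ≡⟨ ⊗-identityˡ f .coeff n ⟩
    f n                               ∎
    where
    open ≡-Reasoning
    shift-X : shift X ≐ oneP
    shift-X .coeff zero    = refl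
    shift-X .coeff (suc k) = refl

  -- `invCoeffs` accumulates with a helper that Defs keeps private. `weighted′` is
  -- that helper: its body is a metavariable, solved from the goal of `invCoeffs-suc`
  -- once `with` has abstracted the arguments of the helper to variables.
  mutual
    weighted′ : ℕ → List ℚ → PS → ℚ
    weighted′ = _

    invCoeffs-suc : ∀ f n →
      invCoeffs f (suc n) ≡ (- (recip (f 0) * weighted′ 0 (invCoeffs f n) f)) ∷ invCoeffs f n
    invCoeffs-suc f n with recip (f 0) | invCoeffs f n
    ... | r | gs with 0
    ... | z = refl

  weighted′-invCoeffs : ∀ f n j → weighted′ j (invCoeffs f n) f ≡ ((λ k → f (suc (j ℕ.+ k))) ⊗ invP f) n
  weighted′-invCoeffs f zero j = begin
    f (suc j) * recip (f 0) + 0ℚ            ≡⟨ +-identityʳ _ ⟩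
    f (suc j) * recip (f 0)                 ≡⟨ cong (λ i → f (suc i) * recip (f 0)) (ℕ.+-identityʳ j) ⟨
    f (suc (j ℕ.+ 0)) * invP f 0            ≡⟨ ⊗-at-zero (λ k → f (suc (j ℕ.+ k))) (invP f) ⟨
    ((λ k → f (suc (j ℕ.+ k))) ⊗ invP f) 0  ∎
    where open ≡-Reasoning
  weighted′-invCoeffs f (suc n) j = begin
    weighted′ j (invCoeffs f (suc n)) f
      ≡⟨ cong (λ gs → weighted′ j gs f) (invCoeffs-suc f n) ⟩
    f (suc j) * invP f (suc n) + weighted′ (suc j) (invCoeffs f n) f
      ≡⟨ cong₂ _+_ (cong (λ i → f (suc i) * invP f (suc n)) (sym (ℕ.+-identityʳ j)))
                   (trans (weighted′-invCoeffs f n (suc j)) (⊗-cong j+suc (≐-refl {invP f}) .coeff n)) ⟩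
    f (suc (j ℕ.+ 0)) * invP f (suc n) + (shift (λ k → f (suc (j ℕ.+ k))) ⊗ invP f) n
      ≡⟨ ⊗-at-suc (λ k → f (suc (j ℕ.+ k))) (invP f) n ⟨
    ((λ k → f (suc (j ℕ.+ k))) ⊗ invP f) (suc n)
      ∎
    where
    open ≡-Reasoning
    j+suc : (λ k → f (suc (suc j ℕ.+ k))) ≐ shift (λ k → f (suc (j ℕ.+ k)))
    j+suc .coeff k = cong (λ i → f (suc i)) (sym (ℕ.+-suc j k))

  recip-inverseʳ : ∀ p → p ≢ 0ℚ → p * recip p ≡ 1ℚ
  recip-inverseʳ p p≢0 with p ≟ 0ℚ
  ... | yes p≡0 = contradiction p≡0 p≢0
  ... | no p≢0  = *-inverseʳ p {{≢-nonZero p≢0}}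

  ⊗-invP : ∀ f → f 0 ≢ 0ℚ → f ⊗ invP f ≐ oneP
  ⊗-invP f f₀≢0 .coeff zero = trans (⊗-at-zero f (invP f)) (recip-inverseʳ (f 0) f₀≢0)
  ⊗-invP f f₀≢0 .coeff (suc n) = begin
    (f ⊗ invP f) (suc n)                         ≡⟨ ⊗-at-suc f (invP f) n ⟩
    f 0 * invP f (suc n) + (shift f ⊗ invP f) n  ≡⟨ cong (f 0 * invP f (suc n) +_) (weighted′-invCoeffs f n 0) ⟨
    f 0 * (- (recip (f 0) * w)) + w              ≡⟨ cancel (f 0) (recip (f 0)) w ⟩
    (1ℚ - f 0 * recip (f 0)) * w                 ≡⟨ cong (λ r → (1ℚ - r) * w) (recip-inverseʳ (f 0) f₀≢0) ⟩
    (1ℚ - 1ℚ) * w                                ≡⟨ cong (_* w) (+-inverseʳ 1ℚ) ⟩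
    0ℚ * w                                       ≡⟨ *-zeroˡ w ⟩
    0ℚ                                           ∎
    where
    open ≡-Reasoning
    open +-*-Solver
    w = weighted′ 0 (invCoeffs f n) f
    cancel : ∀ a r w → a * (- (r * w)) + w ≡ (1ℚ - a * r) * w
    cancel = solve 3 (λ a r w → a :* (:- (r :* w)) :+ w := (con 1ℚ :- a :* r) :* w) refl

  ⊗-cancelʳ : ∀ {f h} g → g 0 ≢ 0ℚ → f ⊗ g ≐ h ⊗ g → f ≐ h
  ⊗-cancelʳ {f} {h} g g₀≢0 fg≐hg = begin
    f                 ≈⟨ ⊗-identityʳ f ⟨
    f ⊗ oneP          ≈⟨ ⊗-congˡ f (⊗-invP g g₀≢0) ⟨
    f ⊗ (g ⊗ invP g)  ≈⟨ ⊗-assoc f g (invP g) ⟨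
    (f ⊗ g) ⊗ invP g  ≈⟨ ⊗-congʳ (invP g) fg≐hg ⟩
    (h ⊗ g) ⊗ invP g  ≈⟨ ⊗-assoc h g (invP g) ⟩
    h ⊗ (g ⊗ invP g)  ≈⟨ ⊗-congˡ h (⊗-invP g g₀≢0) ⟩
    h ⊗ oneP          ≈⟨ ⊗-identityʳ h ⟩
    h                 ∎
    where open ≐-Reasoning

  ⊗≐⇒≐⊗invP : ∀ {f h} g → g 0 ≢ 0ℚ → f ⊗ g ≐ h → f ≐ h ⊗ invP g
  ⊗≐⇒≐⊗invP {f} {h} g g₀≢0 fg≐h = ⊗-cancelʳ g g₀≢0 (begin
    f ⊗ g             ≈⟨ fg≐h ⟩
    h                 ≈⟨ ⊗-identityʳ h ⟨
    h ⊗ oneP          ≈⟨ ⊗-congˡ h (⊗-invP g g₀≢0) ⟨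
    h ⊗ (g ⊗ invP g)  ≈⟨ ⊗-congˡ h (⊗-comm g (invP g)) ⟩
    h ⊗ (invP g ⊗ g)  ≈⟨ ⊗-assoc h (invP g) g ⟨
    (h ⊗ invP g) ⊗ g  ∎)
    where open ≐-Reasoning

  VanishesBelow : ℕ → PS → Set
  VanishesBelow m f = ∀ k → k < m → f k ≡ 0ℚ

  ⊗-vanishesBelow : ∀ {a b f g} → VanishesBelow a f → VanishesBelow b g → VanishesBelow (a ℕ.+ b) (f ⊗ g)
  ⊗-vanishesBelow {zero} {f = f} {g} vf vg zero k<b =
    trans (⊗-at-zero f g) (trans (cong (f 0 *_) (vg 0 k<b)) (*-zeroʳ (f 0)))
  ⊗-vanishesBelow {zero} {f = f} {g} vf vg (suc k) k<b = begin
    (f ⊗ g) (suc k)                    ≡⟨ ⊗-at-suc f g k ⟩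
    f 0 * g (suc k) + (shift f ⊗ g) k  ≡⟨ cong₂ _+_ (trans (cong (f 0 *_) (vg (suc k) k<b)) (*-zeroʳ (f 0)))
                                                      (⊗-vanishesBelow {zero} {f = shift f} (λ _ ()) vg k (ℕ.<-pred (ℕ.m<n⇒m<1+n k<b))) ⟩
    0ℚ + 0ℚ  ≡⟨ +-identityʳ 0ℚ ⟩
    0ℚ       ∎
    where open ≡-Reasoning
  ⊗-vanishesBelow {suc a} {f = f} {g} vf vg zero _ =
    trans (⊗-at-zero f g) (trans (cong (_* g 0) (vf 0 (s≤s z≤n))) (*-zeroˡ (g 0)))
  ⊗-vanishesBelow {suc a} {f = f} {g} vf vg (suc k) (s≤s k<a+b) = begin
    (f ⊗ g) (suc k)                    ≡⟨ ⊗-at-suc f g k ⟩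
    f 0 * g (suc k) + (shift f ⊗ g) k  ≡⟨ cong₂ _+_ (trans (cong (_* g (suc k)) (vf 0 (s≤s z≤n))) (*-zeroˡ (g (suc k))))
                                                      (⊗-vanishesBelow {a} {f = shift f} (λ j j<a → vf (suc j) (s≤s j<a)) vg k k<a+b) ⟩
    0ℚ + 0ℚ  ≡⟨ +-identityʳ 0ℚ ⟩
    0ℚ       ∎
    where open ≡-Reasoning

  prodP-cong : ∀ m {f g : ℕ → PS} → (∀ i → f i ≐ g i) → prodP m f ≐ prodP m g
  prodP-cong zero    f≐g = ≐-refl
  prodP-cong (suc m) f≐g = ⊗-cong (prodP-cong m f≐g) (f≐g m)

  prodP-suc : ∀ m (f : ℕ → PS) → prodP (suc m) f ≐ f 0 ⊗ prodP m (λ i → f (suc i))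
  prodP-suc zero    f = ≐-trans (⊗-identityˡ (f 0)) (≐-sym (⊗-identityʳ (f 0)))
  prodP-suc (suc m) f = begin
    prodP (suc m) f ⊗ f (suc m)                    ≈⟨ ⊗-congʳ (f (suc m)) (prodP-suc m f) ⟩
    f 0 ⊗ prodP m (λ i → f (suc i)) ⊗ f (suc m)    ≈⟨ ⊗-assoc (f 0) _ (f (suc m)) ⟩
    f 0 ⊗ (prodP m (λ i → f (suc i)) ⊗ f (suc m))  ∎
    where open ≐-Reasoning

module Binomial where

  open import Data.Nat using (zero; suc; _+_; _*_; _<_; z≤n; s≤s)
  open import Data.Nat.Properties
  open import Data.Nat.Combinatorics using (_C_; nCk+nC[k+1]≡[n+1]C[k+1]; k>n⇒nCk≡0; nCk≡nC[n∸k])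
  open import Data.Nat.Solver using (module +-*-Solver)
  open import Data.Integer as ℤ using (-[1+_]; _⊖_)
  import Data.Integer.Properties as ℤ
  open import Data.Product using (∃; _,_)
  open import Data.Sum using (inj₁; inj₂)
  open import Relation.Binary.PropositionalEquality
  open +-*-Solver

  open import Defs using (binomZ)

  pascal : ∀ n k → suc n C suc k ≡ n C k + n C suc k
  pascal n k = sym (nCk+nC[k+1]≡[n+1]C[k+1] n k)

  absorption : ∀ n k → suc k * (suc n C suc k) ≡ suc n * (n C k)
  absorption zero    zero    = refl
  absorption zero    (suc k) = trans (cong (suc (suc k) *_) (k>n⇒nCk≡0 {1} {suc (suc k)} (s≤s (s≤s z≤n)))) (*-zeroʳ (suc (suc k)))
  absorption (suc n) zero    = begin
    1 * (suc (suc n) C 1)  ≡⟨ *-identityˡ _ ⟩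
    suc (suc n) C 1        ≡⟨ pascal (suc n) 0 ⟩
    1 + suc n C 1          ≡⟨ cong suc (trans (sym (*-identityˡ _)) (absorption n 0)) ⟩
    1 + suc n * 1          ∎
    where open ≡-Reasoning
  absorption (suc n) (suc k) = begin
    suc (suc k) * (suc (suc n) C suc (suc k))
      ≡⟨ cong (suc (suc k) *_) (pascal (suc n) (suc k)) ⟩
    suc (suc k) * (suc n C suc k + suc n C suc (suc k))
      ≡⟨ solve 3 (λ k x y → (con 1 :+ k) :* (x :+ y) := x :+ (k :* x :+ (con 1 :+ k) :* y)) refl (suc k) (suc n C suc k) _ ⟩
    suc n C suc k + (suc k * (suc n C suc k) + suc (suc k) * (suc n C suc (suc k)))
      ≡⟨ cong (suc n C suc k +_) (cong₂ _+_ (absorption n k) (absorption n (suc k))) ⟩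
    suc n C suc k + (suc n * (n C k) + suc n * (n C suc k))
      ≡⟨ cong (suc n C suc k +_) (*-distribˡ-+ (suc n) (n C k) (n C suc k)) ⟨
    suc n C suc k + suc n * (n C k + n C suc k)
      ≡⟨ cong (λ c → suc n C suc k + suc n * c) (pascal n k) ⟨
    suc n C suc k + suc n * (suc n C suc k)
      ≡⟨ solve 2 (λ x n → x :+ n :* x := (con 1 :+ n) :* x) refl (suc n C suc k) (suc n) ⟩
    suc (suc n) * (suc n C suc k)
      ∎
    where open ≡-Reasoning

  lower-absorption : ∀ n j → suc j * (n C suc j) + j * (n C j) ≡ n * (n C j)
  lower-absorption zero    zero    = refl
  lower-absorption zero    (suc j) = solve 1 (λ j → (con 2 :+ j) :* con 0 :+ (con 1 :+ j) :* con 0 := con 0) refl j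
  lower-absorption (suc n) zero    = trans (cong (_+ 0) (absorption n 0)) (+-identityʳ _)
  lower-absorption (suc n) (suc j) = begin
    suc (suc j) * (suc n C suc (suc j)) + suc j * (suc n C suc j)  ≡⟨ cong₂ _+_ (absorption n (suc j)) (absorption n j) ⟩
    suc n * (n C suc j) + suc n * (n C j)                          ≡⟨ +-comm (suc n * (n C suc j)) _ ⟩
    suc n * (n C j) + suc n * (n C suc j)                          ≡⟨ *-distribˡ-+ (suc n) (n C j) (n C suc j) ⟨
    suc n * (n C j + n C suc j)                                    ≡⟨ cong (suc n *_) (pascal n j) ⟨
    suc n * (suc n C suc j)                                        ∎
    where open ≡-Reasoning

  upper-absorption : ∀ n j → suc n * (n C j) + j * (suc n C j) ≡ suc n * (suc n C j)
  upper-absorption n zero    = +-identityʳ _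
  upper-absorption n (suc j) = begin
    suc n * (n C suc j) + suc j * (suc n C suc j)  ≡⟨ cong (suc n * (n C suc j) +_) (absorption n j) ⟩
    suc n * (n C suc j) + suc n * (n C j)          ≡⟨ +-comm (suc n * (n C suc j)) _ ⟩
    suc n * (n C j) + suc n * (n C suc j)          ≡⟨ *-distribˡ-+ (suc n) (n C j) (n C suc j) ⟨
    suc n * (n C j + n C suc j)                    ≡⟨ cong (suc n *_) (pascal n j) ⟨
    suc n * (suc n C suc j)                        ∎
    where open ≡-Reasoning

  pascal-twice : ∀ n j → suc (suc n) C suc (suc j) + n C suc (suc j) ≡ 2 * (suc n C suc (suc j)) + n C j
  pascal-twice n j = begin
    suc (suc n) C suc (suc j) + n C suc (suc j)
      ≡⟨ cong (_+ n C suc (suc j)) (trans (pascal (suc n) (suc j)) (cong (_+ suc n C suc (suc j)) (pascal n j))) ⟩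
    n C j + n C suc j + suc n C suc (suc j) + n C suc (suc j)
      ≡⟨ solve 4 (λ a b c e → a :+ b :+ c :+ e := a :+ c :+ (b :+ e)) refl (n C j) (n C suc j) (suc n C suc (suc j)) (n C suc (suc j)) ⟩
    n C j + suc n C suc (suc j) + (n C suc j + n C suc (suc j))
      ≡⟨ cong (n C j + suc n C suc (suc j) +_) (pascal n (suc j)) ⟨
    n C j + suc n C suc (suc j) + suc n C suc (suc j)
      ≡⟨ solve 2 (λ a c → a :+ c :+ c := con 2 :* c :+ a) refl (n C j) (suc n C suc (suc j)) ⟩
    2 * (suc n C suc (suc j)) + n C j
      ∎
    where open ≡-Reasoning

  C-sym : ∀ a b → (a + b) C a ≡ (a + b) C b
  C-sym a b = trans (nCk≡nC[n∸k] (m≤m+n a b)) (cong ((a + b) C_) (m+n∸m≡n a b))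

  binomZ-complement-≤ : ∀ e i j → binomZ (e + (i + j + i)) (ℤ.+ (i + j) ℤ.- ℤ.+ i) ≡ (e + (i + j + i)) C (e + (i + i))
  binomZ-complement-≤ e i j = begin
    binomZ (e + (i + j + i)) (ℤ.+ (i + j) ℤ.- ℤ.+ i)  ≡⟨ cong (binomZ (e + (i + j + i))) lower≡j ⟩
    (e + (i + j + i)) C j                             ≡⟨ cong (_C j) rearrange ⟩
    (j + (e + (i + i))) C j                           ≡⟨ C-sym j (e + (i + i)) ⟩
    (j + (e + (i + i))) C (e + (i + i))               ≡⟨ cong (_C (e + (i + i))) rearrange ⟨
    (e + (i + j + i)) C (e + (i + i))                 ∎
    where
    open ≡-Reasoning
    lower≡j : ℤ.+ (i + j) ℤ.- ℤ.+ i ≡ ℤ.+ j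
    lower≡j = begin
      ℤ.+ (i + j) ℤ.- ℤ.+ i  ≡⟨ ℤ.m-n≡m⊖n (i + j) i ⟩
      (i + j) ⊖ i            ≡⟨ cong ((i + j) ⊖_) (+-identityʳ i) ⟨
      (i + j) ⊖ (i + 0)      ≡⟨ ℤ.+-cancelˡ-⊖ i j 0 ⟩
      ℤ.+ j                  ∎
    rearrange : e + (i + j + i) ≡ j + (e + (i + i))
    rearrange = solve 3 (λ e i j → e :+ (i :+ j :+ i) := j :+ (e :+ (i :+ i))) refl e i j

  -- Negative lower index: binomZ is 0 there, and so is the binomial with the
  -- complementary lower index, which exceeds the upper one.
  binomZ-complement-> : ∀ e k x → binomZ (e + (k + suc (k + x))) (ℤ.+ k ℤ.- ℤ.+ suc (k + x))
                                   ≡ (e + (k + suc (k + x))) C (e + (suc (k + x) + suc (k + x)))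
  binomZ-complement-> e k x = begin
    binomZ (e + (k + suc (k + x))) (ℤ.+ k ℤ.- ℤ.+ suc (k + x))   ≡⟨ cong (binomZ (e + (k + suc (k + x)))) lower<0 ⟩
    0                                                            ≡⟨ k>n⇒nCk≡0 (+-monoʳ-< e (+-monoˡ-< (suc (k + x)) (m≤m+n (suc k) x))) ⟨
    (e + (k + suc (k + x))) C (e + (suc (k + x) + suc (k + x)))  ∎
    where
    open ≡-Reasoning
    lower<0 : ℤ.+ k ℤ.- ℤ.+ suc (k + x) ≡ -[1+ x ]
    lower<0 = begin
      ℤ.+ k ℤ.- ℤ.+ suc (k + x)  ≡⟨ ℤ.m-n≡m⊖n k (suc (k + x)) ⟩
      k ⊖ suc (k + x)            ≡⟨ cong₂ _⊖_ (+-identityʳ k) (+-suc k x) ⟨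
      (k + 0) ⊖ (k + suc x)      ≡⟨ ℤ.+-cancelˡ-⊖ k 0 (suc x) ⟩
      -[1+ x ]                   ∎

  binomZ-complement : ∀ e k i → binomZ (e + (k + i)) (ℤ.+ k ℤ.- ℤ.+ i) ≡ (e + (k + i)) C (e + (i + i))
  binomZ-complement e k i with ≤-<-connex i k
  ... | inj₁ i≤k = above (m≤n⇒∃[o]m+o≡n i≤k)
    where
    above : ∃ (λ j → i + j ≡ k) → binomZ (e + (k + i)) (ℤ.+ k ℤ.- ℤ.+ i) ≡ (e + (k + i)) C (e + (i + i))
    above (j , refl) = binomZ-complement-≤ e i j
  ... | inj₂ k<i = below (m≤n⇒∃[o]m+o≡n k<i)
    where
    below : ∃ (λ x → suc k + x ≡ i) → binomZ (e + (k + i)) (ℤ.+ k ℤ.- ℤ.+ i) ≡ (e + (k + i)) C (e + (i + i))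
    below (x , refl) = binomZ-complement-> e k x

module Coefficients where

  open import Data.Bool using (true; false; if_then_else_)
  open import Data.Nat as ℕ using (ℕ; zero; suc; _+_; _*_; _∸_; _^_; _<_; _%_; _/_; z≤n; s≤s)
  open import Data.Nat.Properties
  open import Data.Nat.DivMod using ([m+n]%n≡m%n; m/n≡1+[m∸n]/n)
  open import Data.Nat.Combinatorics using (_C_; k>n⇒nCk≡0)
  open import Data.Nat.Solver using (module +-*-Solver)
  open import Data.Integer as ℤ using ()
  open import Data.Rational as ℚ using (1ℚ)
  import Data.Rational.Properties as ℚ
  open import Relation.Binary.PropositionalEquality
  open +-*-Solver

  open import Defs using (binomZ; isEven; lowE; αc; δc)
  open NatCast
  open Binomial

  double : ℕ → ℕ
  double zero    = 0
  double (suc k) = suc (suc (double k))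

  double≡+ : ∀ k → double k ≡ k + k
  double≡+ zero    = refl
  double≡+ (suc k) = cong suc (trans (cong suc (double≡+ k)) (sym (+-suc k k)))

  data Parity : ℕ → Set where
    even : ∀ k → Parity (double k)
    odd  : ∀ k → Parity (suc (double k))

  parity : ∀ m → Parity m
  parity zero = even 0
  parity (suc m) with parity m
  ... | even k = odd k
  ... | odd k  = even (suc k)

  %2-suc-suc : ∀ m → suc (suc m) % 2 ≡ m % 2
  %2-suc-suc m = trans (cong (_% 2) (+-comm 2 m)) ([m+n]%n≡m%n m 2)

  /2-suc-suc : ∀ m → suc (suc m) / 2 ≡ suc (m / 2)
  /2-suc-suc m = m/n≡1+[m∸n]/n {suc (suc m)} {2} (s≤s (s≤s z≤n))

  isEven-double : ∀ k → isEven (double k) ≡ true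
  isEven-double zero    = refl
  isEven-double (suc k) = trans (cong (ℕ._≡ᵇ 0) (%2-suc-suc (double k))) (isEven-double k)

  isEven-suc-double : ∀ k → isEven (suc (double k)) ≡ false
  isEven-suc-double zero    = refl
  isEven-suc-double (suc k) = trans (cong (ℕ._≡ᵇ 0) (%2-suc-suc (suc (double k)))) (isEven-suc-double k)

  double/2 : ∀ k → double k / 2 ≡ k
  double/2 zero    = refl
  double/2 (suc k) = trans (/2-suc-suc (double k)) (cong suc (double/2 k))

  double+2*/2 : ∀ k i → (double k + 2 * i) / 2 ≡ k + i
  double+2*/2 k i = trans (cong (_/ 2) double+2*) (double/2 (k + i))
    where
    double+2* : double k + 2 * i ≡ double (k + i)
    double+2* = begin
      double k + 2 * i   ≡⟨ cong (_+ 2 * i) (double≡+ k) ⟩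
      k + k + 2 * i      ≡⟨ solve 2 (λ k i → k :+ k :+ con 2 :* i := (k :+ i) :+ (k :+ i)) refl k i ⟩
      (k + i) + (k + i)  ≡⟨ double≡+ (k + i) ⟨
      double (k + i)     ∎
      where open ≡-Reasoning

  -- Division-free forms of δ_{2k+1,i}, α_{2k+1,i}, δ_{2k+2,i} and α_{2k,i}.
  oddδ : ℕ → ℕ → ℕ
  oddδ k i = 2 ^ i * ((k + i) C (i + i))

  oddα : ℕ → ℕ → ℕ
  oddα k i = 2 ^ suc i * (suc (k + i) C suc (i + i))

  evenδ : ℕ → ℕ → ℕ
  evenδ k zero    = 1
  evenδ k (suc i) = 2 ^ i * (suc (k + i) C suc (suc (i + i)) + suc (suc (k + i)) C suc (suc (i + i)))

  evenα : ℕ → ℕ → ℕ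
  evenα k i = 2 ^ i * (suc (k + i) C suc (i + i) + (k + i) C suc (i + i))

  evenδ-clears-denominator : ∀ k i →
    (suc (suc (double k)) + 2 * i) * evenδ k i ≡ suc (suc (double k)) * 2 ^ i * ((suc k + i) C (i + i))
  evenδ-clears-denominator k zero = solve 1 (λ m → (m :+ con 0) :* con 1 := m :* con 1 :* con 1) refl (suc (suc (double k)))
  evenδ-clears-denominator k (suc i) = +-cancelʳ-≡ (2 * p * j * c₁) _ _ (begin
    (M + 2 * suc i) * (p * (c₀ + c₁)) + 2 * p * j * c₁
      ≡⟨ cong (λ d → (suc (suc d) + 2 * suc i) * (p * (c₀ + c₁)) + 2 * p * j * c₁) (double≡+ k) ⟩
    (suc (suc (k + k)) + 2 * suc i) * (p * (c₀ + c₁)) + 2 * p * j * c₁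
      ≡⟨ solve 5 (λ k i p c₀ c₁ → (con 2 :+ (k :+ k) :+ con 2 :* (con 1 :+ i)) :* (p :* (c₀ :+ c₁)) :+ con 2 :* p :* (con 2 :+ (i :+ i)) :* c₁
                                 := con 2 :* p :* ((con 2 :+ k :+ i) :* c₀ :+ (con 2 :+ (i :+ i)) :* c₁) :+ con 2 :* p :* (con 2 :+ k :+ i) :* c₁)
               refl k i p c₀ c₁ ⟩
    2 * p * (suc n * c₀ + j * c₁) + 2 * p * suc n * c₁
      ≡⟨ cong (λ s → 2 * p * s + 2 * p * suc n * c₁) (upper-absorption n j) ⟩
    2 * p * (suc n * c₁) + 2 * p * suc n * c₁
      ≡⟨ solve 4 (λ k i p c₁ → con 2 :* p :* ((con 2 :+ k :+ i) :* c₁) :+ con 2 :* p :* (con 2 :+ k :+ i) :* c₁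
                              := (con 2 :+ (k :+ k)) :* (con 2 :* p) :* c₁ :+ con 2 :* p :* (con 2 :+ (i :+ i)) :* c₁)
               refl k i p c₁ ⟩
    suc (suc (k + k)) * (2 * p) * c₁ + 2 * p * j * c₁
      ≡⟨ cong (λ d → suc (suc d) * (2 * p) * c₁ + 2 * p * j * c₁) (double≡+ k) ⟨
    M * (2 * p) * c₁ + 2 * p * j * c₁
      ≡⟨ cong (λ c → M * (2 * p) * c + 2 * p * j * c₁) (cong₂ _C_ (+-suc (suc k) i) (+-suc (suc i) i)) ⟨
    M * 2 ^ suc i * ((suc k + suc i) C (suc i + suc i)) + 2 * p * j * c₁
      ∎)
    where
    open ≡-Reasoning
    M = suc (suc (double k))
    p = 2 ^ i
    n = suc (k + i)
    j = suc (suc (i + i))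
    c₀ = n C j
    c₁ = suc n C j

  evenα-clears-denominator : ∀ k i → suc (2 * i) * evenα k i ≡ (double k + 1) * 2 ^ i * ((k + i) C (i + i))
  evenα-clears-denominator k i = +-cancelʳ-≡ (p * (i + i) * c) _ _ (begin
    suc (2 * i) * (p * (u + v)) + p * (i + i) * c
      ≡⟨ solve 5 (λ i p u v c → (con 1 :+ con 2 :* i) :* (p :* (u :+ v)) :+ p :* (i :+ i) :* c
                               := p :* ((con 1 :+ (i :+ i)) :* u :+ ((con 1 :+ (i :+ i)) :* v :+ (i :+ i) :* c))) refl i p u v c ⟩
    p * (suc (i + i) * u + (suc (i + i) * v + (i + i) * c))
      ≡⟨ cong₂ (λ a b → p * (a + b)) (absorption (k + i) (i + i)) (lower-absorption (k + i) (i + i)) ⟩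
    p * (suc (k + i) * c + (k + i) * c)
      ≡⟨ solve 4 (λ k i p c → p :* ((con 1 :+ (k :+ i)) :* c :+ (k :+ i) :* c) := ((k :+ k) :+ con 1) :* p :* c :+ p :* (i :+ i) :* c) refl k i p c ⟩
    (k + k + 1) * p * c + p * (i + i) * c
      ≡⟨ cong (λ d → (d + 1) * p * c + p * (i + i) * c) (double≡+ k) ⟨
    (double k + 1) * p * c + p * (i + i) * c
      ∎)
    where
    open ≡-Reasoning
    p = 2 ^ i
    c = (k + i) C (i + i)
    u = suc (k + i) C suc (i + i)
    v = (k + i) C suc (i + i)

  -- The branches of δc and αc are selected by these lemmas: `rewrite` or `with` on
  -- the parity test would normalise the goal, and normalising ℚ arithmetic on open
  -- terms (gcds) exhausts memory. For the same reason the case analyses below pass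
  -- `parity m` to a local function instead of using `with`.
  if-true : ∀ {A : Set} {b} {x y : A} → b ≡ true → (if b then x else y) ≡ x
  if-true refl = refl

  if-false : ∀ {A : Set} {b} {x y : A} → b ≡ false → (if b then x else y) ≡ y
  if-false refl = refl

  -- The index is taken up to an ℕ-equation, discharged by `refl` at use sites:
  -- comparing δc at two merely convertible indices would unfold ℚ arithmetic too.
  δc-odd : ∀ {m} k i → m ≡ double k → δc (suc m) i ≡ ι (oddδ k i)
  δc-odd k i refl = begin
    δc (suc (double k)) i
      ≡⟨ if-false (isEven-suc-double k) ⟩
    ι (2 ^ i * binomZ ((double k + 2 * i) / 2) (ℤ.+ (double k / 2) ℤ.- ℤ.+ i))
      ≡⟨ cong₂ (λ n h → ι (2 ^ i * binomZ n (ℤ.+ h ℤ.- ℤ.+ i))) (double+2*/2 k i) (double/2 k) ⟩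
    ι (2 ^ i * binomZ (k + i) (ℤ.+ k ℤ.- ℤ.+ i))
      ≡⟨ cong (λ c → ι (2 ^ i * c)) (binomZ-complement 0 k i) ⟩
    ι (oddδ k i)
      ∎
    where open ≡-Reasoning

  suc-double+2*+1/2 : ∀ k i → (suc (double k) + 2 * i + 1) / 2 ≡ suc (k + i)
  suc-double+2*+1/2 k i = begin
    (suc (double k) + 2 * i + 1) / 2  ≡⟨ cong (_/ 2) (solve 2 (λ d i → con 1 :+ d :+ con 2 :* i :+ con 1 := con 2 :+ (d :+ con 2 :* i)) refl (double k) i) ⟩
    suc (suc (double k + 2 * i)) / 2  ≡⟨ /2-suc-suc (double k + 2 * i) ⟩
    suc ((double k + 2 * i) / 2)      ≡⟨ cong suc (double+2*/2 k i) ⟩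
    suc (k + i)                       ∎
    where open ≡-Reasoning

  αc-odd : ∀ {m} k i → m ≡ suc (double k) → αc m i ≡ ι (oddα k i)
  αc-odd k i refl = begin
    αc (suc (double k)) i
      ≡⟨ if-false (isEven-suc-double k) ⟩
    ι (2 ^ (i + 1) * binomZ ((suc (double k) + 2 * i + 1) / 2) (ℤ.+ (double k / 2) ℤ.- ℤ.+ i))
      ≡⟨ cong₂ (λ n h → ι (2 ^ (i + 1) * binomZ n (ℤ.+ h ℤ.- ℤ.+ i))) (suc-double+2*+1/2 k i) (double/2 k) ⟩
    ι (2 ^ (i + 1) * binomZ (suc (k + i)) (ℤ.+ k ℤ.- ℤ.+ i))
      ≡⟨ cong₂ (λ e c → ι (2 ^ e * c)) (+-comm i 1) (binomZ-complement 1 k i) ⟩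
    ι (oddα k i)
      ∎
    where open ≡-Reasoning

  δc-even : ∀ {m} k i → m ≡ suc (double k) → δc (suc m) i ≡ ι (evenδ k i)
  δc-even k i refl = begin
    δc (suc (suc (double k))) i
      ≡⟨ if-true (isEven-double (suc k)) ⟩
    (ℤ.+ (M * 2 ^ i) ℚ./ (M + 2 * i)) ℚ.* ι (binomZ ((M + 2 * i) / 2) (ℤ.+ (M / 2) ℤ.- ℤ.+ i))
      ≡⟨ cong₂ (λ n h → (ℤ.+ (M * 2 ^ i) ℚ./ (M + 2 * i)) ℚ.* ι (binomZ n (ℤ.+ h ℤ.- ℤ.+ i))) (double+2*/2 (suc k) i) (double/2 (suc k)) ⟩
    (ℤ.+ (M * 2 ^ i) ℚ./ (M + 2 * i)) ℚ.* ι (binomZ (suc k + i) (ℤ.+ suc k ℤ.- ℤ.+ i))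
      ≡⟨ cong (λ c → (ℤ.+ (M * 2 ^ i) ℚ./ (M + 2 * i)) ℚ.* ι c) (binomZ-complement 0 (suc k) i) ⟩
    (ℤ.+ (M * 2 ^ i) ℚ./ (M + 2 * i)) ℚ.* ι ((suc k + i) C (i + i))
      ≡⟨ /-*-ι (M * 2 ^ i) (M + 2 * i) ((suc k + i) C (i + i)) (evenδ k i) (evenδ-clears-denominator k i) ⟩
    ι (evenδ k i)
      ∎
    where
    open ≡-Reasoning
    M = suc (suc (double k))

  αc-even : ∀ {m} k i → m ≡ double k → αc m i ≡ ι (evenα k i)
  αc-even k i refl = begin
    αc (double k) i
      ≡⟨ if-true (isEven-double k) ⟩
    (ℤ.+ ((double k + 1) * 2 ^ i) ℚ./ suc (2 * i)) ℚ.* ι (binomZ ((double k + 2 * i) / 2) (ℤ.+ (double k / 2) ℤ.- ℤ.+ i))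
      ≡⟨ cong₂ (λ n h → (ℤ.+ ((double k + 1) * 2 ^ i) ℚ./ suc (2 * i)) ℚ.* ι (binomZ n (ℤ.+ h ℤ.- ℤ.+ i))) (double+2*/2 k i) (double/2 k) ⟩
    (ℤ.+ ((double k + 1) * 2 ^ i) ℚ./ suc (2 * i)) ℚ.* ι (binomZ (k + i) (ℤ.+ k ℤ.- ℤ.+ i))
      ≡⟨ cong (λ c → (ℤ.+ ((double k + 1) * 2 ^ i) ℚ./ suc (2 * i)) ℚ.* ι c) (binomZ-complement 0 k i) ⟩
    (ℤ.+ ((double k + 1) * 2 ^ i) ℚ./ suc (2 * i)) ℚ.* ι ((k + i) C (i + i))
      ≡⟨ /-*-ι ((double k + 1) * 2 ^ i) (suc (2 * i)) ((k + i) C (i + i)) (evenα k i) (evenα-clears-denominator k i) ⟩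
    ι (evenα k i)
      ∎
    where open ≡-Reasoning

  oddδ-suc : ∀ k i → oddδ k (suc i) ≡ 2 * 2 ^ i * (suc (k + i) C suc (suc (i + i)))
  oddδ-suc k i = cong (2 * 2 ^ i *_) (cong₂ _C_ (+-suc k i) (+-suc (suc i) i))

  oddδ-step : ∀ k i → oddα k i + oddδ k (suc i) ≡ oddδ (suc k) (suc i)
  oddδ-step k i = begin
    oddα k i + oddδ k (suc i)
      ≡⟨ cong (oddα k i +_) (oddδ-suc k i) ⟩
    2 * 2 ^ i * (suc (k + i) C suc (i + i)) + 2 * 2 ^ i * (suc (k + i) C suc (suc (i + i)))
      ≡⟨ *-distribˡ-+ (2 * 2 ^ i) _ _ ⟨
    2 * 2 ^ i * (suc (k + i) C suc (i + i) + suc (k + i) C suc (suc (i + i)))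
      ≡⟨ cong (2 * 2 ^ i *_) (pascal (suc (k + i)) (suc (i + i))) ⟨
    2 * 2 ^ i * (suc (suc (k + i)) C suc (suc (i + i)))
      ≡⟨ oddδ-suc (suc k) i ⟨
    oddδ (suc k) (suc i)
      ∎
    where open ≡-Reasoning

  evenδ-step : ∀ k i → evenα (suc k) i + evenδ k (suc i) ≡ evenδ (suc k) (suc i)
  evenδ-step k i = begin
    p * (C[n+1,j] + C[n,j]) + p * (C[n,j+1] + C[n+1,j+1])
      ≡⟨ solve 5 (λ p a b c d → p :* (c :+ a) :+ p :* (b :+ d) := p :* ((a :+ b) :+ (c :+ d))) refl p C[n,j] C[n,j+1] C[n+1,j] C[n+1,j+1] ⟩
    p * ((C[n,j] + C[n,j+1]) + (C[n+1,j] + C[n+1,j+1]))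
      ≡⟨ cong₂ (λ a b → p * (a + b)) (pascal n j) (pascal (suc n) j) ⟨
    p * (suc n C suc j + suc (suc n) C suc j)
      ∎
    where
    open ≡-Reasoning
    p = 2 ^ i
    n = suc (k + i)
    j = suc (i + i)
    C[n,j] = n C j
    C[n,j+1] = n C suc j
    C[n+1,j] = suc n C j
    C[n+1,j+1] = suc n C suc j

  evenδ-step-zero : ∀ i → evenα 0 i ≡ evenδ 0 (suc i)
  evenδ-step-zero i = cong (2 ^ i *_) (begin
    suc i C suc (i + i) + i C suc (i + i)                        ≡⟨ cong (suc i C suc (i + i) +_) (k>n⇒nCk≡0 (s≤s (m≤m+n i i))) ⟩
    suc i C suc (i + i) + 0                                      ≡⟨ cong (suc i C suc (i + i) +_) C[1+i,2+2i]≡0 ⟨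
    suc i C suc (i + i) + suc i C suc (suc (i + i))              ≡⟨ pascal (suc i) (suc (i + i)) ⟨
    suc (suc i) C suc (suc (i + i))                              ≡⟨ cong (_+ suc (suc i) C suc (suc (i + i))) C[1+i,2+2i]≡0 ⟨
    suc i C suc (suc (i + i)) + suc (suc i) C suc (suc (i + i))  ∎)
    where
    open ≡-Reasoning
    C[1+i,2+2i]≡0 : suc i C suc (suc (i + i)) ≡ 0
    C[1+i,2+2i]≡0 = k>n⇒nCk≡0 (s≤s (s≤s (m≤m+n i i)))

  oddδ-recurrence : ∀ k i → oddδ (suc (suc k)) (suc i) + oddδ k (suc i) ≡ 2 * oddδ (suc k) (suc i) + 2 * oddδ (suc k) i
  oddδ-recurrence k i = begin
    oddδ (suc (suc k)) (suc i) + oddδ k (suc i)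
      ≡⟨ cong₂ _+_ (oddδ-suc (suc (suc k)) i) (oddδ-suc k i) ⟩
    2 * p * (suc (suc n) C j) + 2 * p * (n C j)
      ≡⟨ *-distribˡ-+ (2 * p) _ _ ⟨
    2 * p * (suc (suc n) C j + n C j)
      ≡⟨ cong (2 * p *_) (pascal-twice n (i + i)) ⟩
    2 * p * (2 * (suc n C j) + n C (i + i))
      ≡⟨ solve 3 (λ p x y → con 2 :* p :* (con 2 :* x :+ y) := con 2 :* (con 2 :* p :* x) :+ con 2 :* (p :* y)) refl p (suc n C j) (n C (i + i)) ⟩
    2 * (2 * p * (suc n C j)) + 2 * (p * (n C (i + i)))
      ≡⟨ cong (λ x → 2 * x + 2 * oddδ (suc k) i) (oddδ-suc (suc k) i) ⟨
    2 * oddδ (suc k) (suc i) + 2 * oddδ (suc k) i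
      ∎
    where
    open ≡-Reasoning
    p = 2 ^ i
    n = suc (k + i)
    j = suc (suc (i + i))

  evenδ-average : ∀ k i → 2 * evenδ k i ≡ oddδ k i + oddδ (suc k) i
  evenδ-average k zero    = refl
  evenδ-average k (suc i) = begin
    2 * (2 ^ i * (suc (k + i) C j + suc (suc (k + i)) C j))
      ≡⟨ solve 3 (λ p x y → con 2 :* (p :* (x :+ y)) := con 2 :* p :* x :+ con 2 :* p :* y) refl (2 ^ i) _ _ ⟩
    2 * 2 ^ i * (suc (k + i) C j) + 2 * 2 ^ i * (suc (suc (k + i)) C j)
      ≡⟨ cong₂ _+_ (oddδ-suc k i) (oddδ-suc (suc k) i) ⟨
    oddδ k (suc i) + oddδ (suc k) (suc i)
      ∎
    where
    open ≡-Reasoning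
    j = suc (suc (i + i))

  evenδ-recurrence : ∀ k i → evenδ (suc (suc k)) (suc i) + evenδ k (suc i) ≡ 2 * evenδ (suc k) (suc i) + 2 * evenδ (suc k) i
  evenδ-recurrence k i = *-cancelˡ-≡ _ _ 2 (begin
    2 * (evenδ (2 + k) (suc i) + evenδ k (suc i))
      ≡⟨ *-distribˡ-+ 2 (evenδ (2 + k) (suc i)) (evenδ k (suc i)) ⟩
    2 * evenδ (2 + k) (suc i) + 2 * evenδ k (suc i)
      ≡⟨ cong₂ _+_ (evenδ-average (2 + k) (suc i)) (evenδ-average k (suc i)) ⟩
    (oddδ (2 + k) (suc i) + oddδ (3 + k) (suc i)) + (oddδ k (suc i) + oddδ (1 + k) (suc i))
      ≡⟨ solve 4 (λ a b c d → (a :+ b) :+ (c :+ d) := (a :+ c) :+ (b :+ d)) refl (oddδ (2 + k) (suc i)) (oddδ (3 + k) (suc i)) (oddδ k (suc i)) (oddδ (1 + k) (suc i)) ⟩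
    (oddδ (2 + k) (suc i) + oddδ k (suc i)) + (oddδ (3 + k) (suc i) + oddδ (1 + k) (suc i))
      ≡⟨ cong₂ _+_ (oddδ-recurrence k i) (oddδ-recurrence (suc k) i) ⟩
    (2 * oddδ (1 + k) (suc i) + 2 * oddδ (1 + k) i) + (2 * oddδ (2 + k) (suc i) + 2 * oddδ (2 + k) i)
      ≡⟨ solve 4 (λ a b c d → (con 2 :* a :+ con 2 :* b) :+ (con 2 :* c :+ con 2 :* d) := con 2 :* (a :+ c) :+ con 2 :* (b :+ d))
               refl (oddδ (1 + k) (suc i)) (oddδ (1 + k) i) (oddδ (2 + k) (suc i)) (oddδ (2 + k) i) ⟩
    2 * (oddδ (1 + k) (suc i) + oddδ (2 + k) (suc i)) + 2 * (oddδ (1 + k) i + oddδ (2 + k) i)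
      ≡⟨ cong₂ (λ a b → 2 * a + 2 * b) (evenδ-average (1 + k) (suc i)) (evenδ-average (1 + k) i) ⟨
    2 * (2 * evenδ (1 + k) (suc i)) + 2 * (2 * evenδ (1 + k) i)
      ≡⟨ *-distribˡ-+ 2 (2 * evenδ (1 + k) (suc i)) (2 * evenδ (1 + k) i) ⟨
    2 * (2 * evenδ (1 + k) (suc i) + 2 * evenδ (1 + k) i)
      ∎)
    where open ≡-Reasoning

  oddδ-vanishes : ∀ {k i} → k < i → oddδ k i ≡ 0
  oddδ-vanishes {k} {i} k<i = trans (cong (2 ^ i *_) (k>n⇒nCk≡0 (+-monoˡ-< i k<i))) (*-zeroʳ (2 ^ i))

  oddα-vanishes : ∀ {k i} → k < i → oddα k i ≡ 0
  oddα-vanishes {k} {i} k<i = trans (cong (2 ^ suc i *_) (k>n⇒nCk≡0 (s≤s (+-monoˡ-< i k<i)))) (*-zeroʳ (2 ^ suc i))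

  evenα-vanishes : ∀ {k i} → k < i → evenα k i ≡ 0
  evenα-vanishes {k} {i} k<i = trans (cong (2 ^ i *_) (cong₂ _+_ {x = suc (k + i) C suc (i + i)} {u = (k + i) C suc (i + i)}
    (k>n⇒nCk≡0 (s≤s (+-monoˡ-< i k<i))) (k>n⇒nCk≡0 (m<n⇒m<1+n (+-monoˡ-< i k<i))))) (*-zeroʳ (2 ^ i))

  evenδ-vanishes : ∀ {k i} → k < i → evenδ k (suc i) ≡ 0
  evenδ-vanishes {k} {i} k<i = trans (cong (2 ^ i *_) (cong₂ _+_ {x = suc (k + i) C j} {u = suc (suc (k + i)) C j}
    (k>n⇒nCk≡0 (s≤s (m<n⇒m<1+n (+-monoˡ-< i k<i)))) (k>n⇒nCk≡0 (s≤s (s≤s (+-monoˡ-< i k<i)))))) (*-zeroʳ (2 ^ i))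
    where j = suc (suc (i + i))

  evenδ-recurrence-zero : ∀ i → evenδ 1 (suc i) ≡ 2 * evenδ 0 (suc i) + 2 * evenδ 0 i
  evenδ-recurrence-zero zero          = refl
  evenδ-recurrence-zero (suc zero)    = refl
  evenδ-recurrence-zero (suc (suc i)) = begin
    evenδ 1 (3 + i)                            ≡⟨ evenδ-vanishes {1} {2 + i} (s≤s (s≤s z≤n)) ⟩
    0                                          ≡⟨ cong₂ (λ a b → 2 * a + 2 * b) (evenδ-vanishes {0} {2 + i} (s≤s z≤n)) (evenδ-vanishes {0} {1 + i} (s≤s z≤n)) ⟨
    2 * evenδ 0 (3 + i) + 2 * evenδ 0 (2 + i)  ∎
    where open ≡-Reasoning

  δc-zero-suc : ∀ i → δc 0 (suc i) ≡ ι 0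
  δc-zero-suc i = /-*-ι 0 (2 * suc i + 0) (binomZ ((2 * suc i) / 2) (lowE 0 (suc i))) 0 (*-zeroʳ (2 * suc i + 0))

  δc-at-zero : ∀ m → δc m 0 ≡ 1ℚ
  δc-at-zero m = at-zero (parity m)
    where
    at-zero : ∀ {m} → Parity m → δc m 0 ≡ 1ℚ
    at-zero (even zero)    = refl
    at-zero (even (suc k)) = δc-even k 0 refl
    at-zero (odd k)        = δc-odd k 0 refl

  δc-step : ∀ m i → δc (suc (suc m)) (suc i) ≡ αc m i ℚ.+ δc m (suc i)
  δc-step m i = step (parity m)
    where
    step : ∀ {m} → Parity m → δc (suc (suc m)) (suc i) ≡ αc m i ℚ.+ δc m (suc i)
    step (even zero)    = sym (ι-step (evenα 0 i) 0 (evenδ 0 (suc i)) (αc-even 0 i refl) (δc-zero-suc i) (δc-even 0 (suc i) refl)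
                                      (trans (+-identityʳ _) (evenδ-step-zero i)))
    step (even (suc k)) = sym (ι-step (evenα (suc k) i) (evenδ k (suc i)) (evenδ (suc k) (suc i))
                                      (αc-even (suc k) i refl) (δc-even k (suc i) refl) (δc-even (suc k) (suc i) refl) (evenδ-step k i))
    step (odd k)        = sym (ι-step (oddα k i) (oddδ k (suc i)) (oddδ (suc k) (suc i))
                                      (αc-odd k i refl) (δc-odd k (suc i) refl) (δc-odd (suc k) (suc i) refl) (oddδ-step k i))

  δc-recurrence : ∀ m i → δc (suc (suc (suc (suc m)))) (suc i) ℚ.+ δc m (suc i)
                        ≡ ι 2 ℚ.* δc (suc (suc m)) (suc i) ℚ.+ ι 2 ℚ.* δc (suc (suc m)) i
  δc-recurrence m i = recurrence (parity m)
    where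
    recurrence : ∀ {m} → Parity m → δc (suc (suc (suc (suc m)))) (suc i) ℚ.+ δc m (suc i)
                                    ≡ ι 2 ℚ.* δc (suc (suc m)) (suc i) ℚ.+ ι 2 ℚ.* δc (suc (suc m)) i
    recurrence (even zero)    = ι-recurrence (evenδ 1 (suc i)) 0 (evenδ 0 (suc i)) (evenδ 0 i)
                                  (δc-even 1 (suc i) refl) (δc-zero-suc i) (δc-even 0 (suc i) refl) (δc-even 0 i refl)
                                  (trans (+-identityʳ _) (evenδ-recurrence-zero i))
    recurrence (even (suc k)) = ι-recurrence (evenδ (suc (suc k)) (suc i)) (evenδ k (suc i)) (evenδ (suc k) (suc i)) (evenδ (suc k) i)
                                  (δc-even (suc (suc k)) (suc i) refl) (δc-even k (suc i) refl) (δc-even (suc k) (suc i) refl) (δc-even (suc k) i refl)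
                                  (evenδ-recurrence k i)
    recurrence (odd k)        = ι-recurrence (oddδ (suc (suc k)) (suc i)) (oddδ k (suc i)) (oddδ (suc k) (suc i)) (oddδ (suc k) i)
                                  (δc-odd (suc (suc k)) (suc i) refl) (δc-odd k (suc i) refl) (δc-odd (suc k) (suc i) refl) (δc-odd (suc k) i refl)
                                  (oddδ-recurrence k i)

module Denominators where

  open import Data.Nat using (ℕ; zero; suc; z≤n; s≤s)
  open import Data.Rational using (0ℚ; 1ℚ; _+_; _*_; -_; _-_)
  open import Data.Rational.Properties
  open import Data.Rational.Solver using (module +-*-Solver)
  open import Relation.Binary.PropositionalEquality

  open import Defs using (constP; oneP; X; _⊕_; _⊖_; _⊗_; abar; d; sgn; αc; δc)
  open NatCast
  open PowerSeries
  open Coefficients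

  d-at-zero : ∀ m → d m 0 ≡ 1ℚ
  d-at-zero m = trans (*-identityˡ (δc m 0)) (δc-at-zero m)

  d-at-zero≢0 : ∀ m → d m 0 ≢ 0ℚ
  d-at-zero≢0 m d₀≡0 = 1≢0 (trans (sym (d-at-zero m)) d₀≡0)

  X⊗abar : ∀ m → X ⊗ abar m ≐ d m ⊖ d (suc (suc m))
  X⊗abar m .coeff zero = begin
    (X ⊗ abar m) 0             ≡⟨ X⊗-at-zero (abar m) ⟩
    0ℚ                         ≡⟨ +-inverseʳ 1ℚ ⟨
    1ℚ - 1ℚ                    ≡⟨ cong₂ (λ u v → u + - v) (d-at-zero m) (d-at-zero (suc (suc m))) ⟨
    d m 0 - d (suc (suc m)) 0  ∎
    where open ≡-Reasoning
  X⊗abar m .coeff (suc i) = begin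
    (X ⊗ abar m) (suc i)                                         ≡⟨ X⊗-at-suc (abar m) i ⟩
    sgn i * αc m i                                               ≡⟨ regroup (sgn i) (αc m i) (δc m (suc i)) ⟩
    - sgn i * δc m (suc i) - - sgn i * (αc m i + δc m (suc i))   ≡⟨ cong (λ δ → - sgn i * δc m (suc i) - - sgn i * δ) (δc-step m i) ⟨
    - sgn i * δc m (suc i) - - sgn i * δc (suc (suc m)) (suc i)  ∎
    where
    open ≡-Reasoning
    open +-*-Solver
    regroup : ∀ s α δ → s * α ≡ - s * δ - - s * (α + δ)
    regroup = solve 3 (λ s α δ → s :* α := (:- s) :* δ :- (:- s) :* (α :+ δ)) refl

  d-recurrence-coeff : ∀ m i → d (suc (suc (suc (suc m)))) i + d m i ≡ ι 2 * d (suc (suc m)) i - ι 2 * (X ⊗ d (suc (suc m))) i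
  d-recurrence-coeff m zero = begin
    d (suc (suc (suc (suc m)))) 0 + d m 0                    ≡⟨ cong₂ _+_ (d-at-zero (suc (suc (suc (suc m))))) (d-at-zero m) ⟩
    1ℚ + 1ℚ                                                  ≡⟨⟩
    ι 2 * 1ℚ - ι 2 * 0ℚ                                      ≡⟨ cong₂ (λ u v → ι 2 * u - ι 2 * v) (d-at-zero (suc (suc m))) (X⊗-at-zero (d (suc (suc m)))) ⟨
    ι 2 * d (suc (suc m)) 0 - ι 2 * (X ⊗ d (suc (suc m))) 0  ∎
    where open ≡-Reasoning
  d-recurrence-coeff m (suc i) = begin
    - s * δc (suc (suc (suc (suc m)))) (suc i) + - s * δc m (suc i)
      ≡⟨ *-distribˡ-+ (- s) _ _ ⟨
    - s * (δc (suc (suc (suc (suc m)))) (suc i) + δc m (suc i))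
      ≡⟨ cong (- s *_) (δc-recurrence m i) ⟩
    - s * (ι 2 * δc (suc (suc m)) (suc i) + ι 2 * δc (suc (suc m)) i)
      ≡⟨ regroup s (ι 2) (δc (suc (suc m)) (suc i)) (δc (suc (suc m)) i) ⟩
    ι 2 * (- s * δc (suc (suc m)) (suc i)) - ι 2 * (s * δc (suc (suc m)) i)
      ≡⟨ cong (λ u → ι 2 * (- s * δc (suc (suc m)) (suc i)) - ι 2 * u) (X⊗-at-suc (d (suc (suc m))) i) ⟨
    ι 2 * d (suc (suc m)) (suc i) - ι 2 * (X ⊗ d (suc (suc m))) (suc i)
      ∎
    where
    open ≡-Reasoning
    open +-*-Solver
    s = sgn i
    regroup : ∀ s t x y → - s * (t * x + t * y) ≡ t * (- s * x) - t * (s * y)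
    regroup = solve 4 (λ s t x y → (:- s) :* (t :* x :+ t :* y) := t :* ((:- s) :* x) :- t :* (s :* y)) refl

  d-recurrence : ∀ m → d (suc (suc (suc (suc m)))) ⊕ d m ≐ constP (ι 2) ⊗ (oneP ⊖ X) ⊗ d (suc (suc m))
  d-recurrence m = begin
    d (suc (suc (suc (suc m)))) ⊕ d m
      ≈⟨ coeffwise (d-recurrence-coeff m) ⟩
    ι 2 · d (suc (suc m)) ⊖ ι 2 · (X ⊗ d (suc (suc m)))
      ≈⟨ ⊖-cong (constP-⊗ (ι 2) (d (suc (suc m)))) (constP-⊗ (ι 2) (X ⊗ d (suc (suc m)))) ⟨
    constP (ι 2) ⊗ d (suc (suc m)) ⊖ constP (ι 2) ⊗ (X ⊗ d (suc (suc m)))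
      ≈⟨ solve 3 (λ c x e → c :* e :- c :* (x :* e) := c :* (con 1ℚ :- x) :* e) ≐-refl (constP (ι 2)) X (d (suc (suc m))) ⟩
    constP (ι 2) ⊗ (oneP ⊖ X) ⊗ d (suc (suc m))
      ∎
    where
    open ≐-Reasoning
    open PS-Solver using (solve; _:*_; _:-_; _:=_; con)

  sgn-*-ι0 : ∀ i {x} → x ≡ ι 0 → sgn i * x ≡ 0ℚ
  sgn-*-ι0 i x≡0 = trans (cong (sgn i *_) x≡0) (*-zeroʳ (sgn i))

  d-zero : d 0 ≐ oneP
  d-zero = constant-series 1ℚ refl λ i → sgn-*-ι0 (suc i) (δc-zero-suc i)

  d-one : d 1 ≐ oneP
  d-one = constant-series 1ℚ refl λ i → sgn-*-ι0 (suc i) (trans (δc-odd 0 (suc i) refl) (cong ι (oddδ-vanishes {0} {suc i} (s≤s z≤n))))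

  abar-zero : abar 0 ≐ oneP
  abar-zero = constant-series 1ℚ refl λ i → sgn-*-ι0 (suc i) (trans (αc-even 0 (suc i) refl) (cong ι (evenα-vanishes {0} {suc i} (s≤s z≤n))))

  abar-one : abar 1 ≐ constP (ι 2)
  abar-one = constant-series (ι 2) refl λ i → sgn-*-ι0 (suc i) (trans (αc-odd 0 (suc i) refl) (cong ι (oddα-vanishes {0} {suc i} (s≤s z≤n))))

  d-step : ∀ m → d (suc (suc m)) ≐ d m ⊖ X ⊗ abar m
  d-step m = begin
    d (suc (suc m))                ≈⟨ solve 2 (λ e g → g := e :- (e :- g)) ≐-refl (d m) (d (suc (suc m))) ⟩
    d m ⊖ (d m ⊖ d (suc (suc m)))  ≈⟨ ⊖-congˡ (d m) (X⊗abar m) ⟨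
    d m ⊖ X ⊗ abar m               ∎
    where
    open ≐-Reasoning
    open PS-Solver using (solve; _:-_; _:=_)

  d-two : d 2 ≐ oneP ⊖ X
  d-two = begin
    d 2               ≈⟨ d-step 0 ⟩
    d 0 ⊖ X ⊗ abar 0  ≈⟨ ⊖-cong d-zero (⊗-congˡ X abar-zero) ⟩
    oneP ⊖ X ⊗ oneP   ≈⟨ ⊖-congˡ oneP (⊗-identityʳ X) ⟩
    oneP ⊖ X          ∎
    where open ≐-Reasoning

  d-three : d 3 ≐ oneP ⊖ X ⊗ constP (ι 2)
  d-three = begin
    d 3                      ≈⟨ d-step 1 ⟩
    d 1 ⊖ X ⊗ abar 1         ≈⟨ ⊖-cong d-one (⊗-congˡ X abar-one) ⟩
    oneP ⊖ X ⊗ constP (ι 2)  ∎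
    where open ≐-Reasoning

  d-four : d 4 ≐ constP (ι 2) ⊗ (oneP ⊖ X) ⊗ (oneP ⊖ X) ⊖ oneP
  d-four = begin
    d 4                                            ≈⟨ solve 2 (λ f z → f := (f :+ z) :- z) ≐-refl (d 4) (d 0) ⟩
    (d 4 ⊕ d 0) ⊖ d 0                              ≈⟨ ⊖-cong (d-recurrence 0) d-zero ⟩
    constP (ι 2) ⊗ (oneP ⊖ X) ⊗ d 2 ⊖ oneP         ≈⟨ ⊖-congʳ oneP (⊗-congˡ (constP (ι 2) ⊗ (oneP ⊖ X)) d-two) ⟩
    constP (ι 2) ⊗ (oneP ⊖ X) ⊗ (oneP ⊖ X) ⊖ oneP  ∎
    where
    open ≐-Reasoning
    open PS-Solver using (solve; _:+_; _:-_; _:=_)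

  Wronskian : ℕ → Set
  Wronskian m = d (suc (suc m)) ⊗ d (suc m) ≐ d (suc (suc (suc m))) ⊗ d m ⊕ X

  wronskian-zero : Wronskian 0
  wronskian-zero = begin
    d 2 ⊗ d 1                             ≈⟨ ⊗-cong d-two d-one ⟩
    (oneP ⊖ X) ⊗ oneP                     ≈⟨ solve 1 (λ x → (con 1ℚ :- x) :* con 1ℚ := (con 1ℚ :- x :* con (ι 2)) :* con 1ℚ :+ x) ≐-refl X ⟩
    (oneP ⊖ X ⊗ constP (ι 2)) ⊗ oneP ⊕ X  ≈⟨ ⊕-congʳ X (⊗-cong d-three d-zero) ⟨
    d 3 ⊗ d 0 ⊕ X                         ∎
    where
    open ≐-Reasoning
    open PS-Solver using (solve; _:+_; _:*_; _:-_; _:=_; con)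

  wronskian-one : Wronskian 1
  wronskian-one = begin
    d 3 ⊗ d 2                               ≈⟨ ⊗-cong d-three d-two ⟩
    (oneP ⊖ X ⊗ constP (ι 2)) ⊗ (oneP ⊖ X)  ≈⟨ solve 1 (λ x → (con 1ℚ :- x :* con (ι 2)) :* (con 1ℚ :- x)
                                                             := (con (ι 2) :* (con 1ℚ :- x) :* (con 1ℚ :- x) :- con 1ℚ) :* con 1ℚ :+ x) ≐-refl X ⟩
    (constP (ι 2) ⊗ (oneP ⊖ X) ⊗ (oneP ⊖ X) ⊖ oneP) ⊗ oneP ⊕ X
                                                ≈⟨ ⊕-congʳ X (⊗-cong d-four d-one) ⟨
    d 4 ⊗ d 1 ⊕ X                               ∎
    where
    open ≐-Reasoning
    open PS-Solver using (solve; _:+_; _:*_; _:-_; _:=_; con)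

  wronskian-step : ∀ m → Wronskian m → Wronskian (suc (suc m))
  wronskian-step m wronskian-m = begin
    d₄ ⊗ d₃
      ≈⟨ solve 3 (λ d₀ d₃ d₄ → d₄ :* d₃ := (d₄ :+ d₀) :* d₃ :- d₀ :* d₃) ≐-refl d₀ d₃ d₄ ⟩
    (d₄ ⊕ d₀) ⊗ d₃ ⊖ d₀ ⊗ d₃
      ≈⟨ ⊖-congʳ (d₀ ⊗ d₃) (⊗-congʳ d₃ (d-recurrence m)) ⟩
    c ⊗ d₂ ⊗ d₃ ⊖ d₀ ⊗ d₃
      ≈⟨ solve 5 (λ c d₀ d₁ d₂ d₃ → c :* d₂ :* d₃ :- d₀ :* d₃ := c :* d₃ :* d₂ :- d₁ :* d₂ :+ (d₂ :* d₁ :- d₃ :* d₀))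
               ≐-refl c d₀ d₁ d₂ d₃ ⟩
    c ⊗ d₃ ⊗ d₂ ⊖ d₁ ⊗ d₂ ⊕ (d₂ ⊗ d₁ ⊖ d₃ ⊗ d₀)
      ≈⟨ ⊕-cong (⊖-congʳ (d₁ ⊗ d₂) (⊗-congʳ d₂ (d-recurrence (suc m)))) (⊖-congʳ (d₃ ⊗ d₀) (≐-sym wronskian-m)) ⟨
    (d₅ ⊕ d₁) ⊗ d₂ ⊖ d₁ ⊗ d₂ ⊕ (d₃ ⊗ d₀ ⊕ X ⊖ d₃ ⊗ d₀)
      ≈⟨ solve 6 (λ d₀ d₁ d₂ d₃ d₅ x → (d₅ :+ d₁) :* d₂ :- d₁ :* d₂ :+ (d₃ :* d₀ :+ x :- d₃ :* d₀) := d₅ :* d₂ :+ x)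
               ≐-refl d₀ d₁ d₂ d₃ d₅ X ⟩
    d₅ ⊗ d₂ ⊕ X
      ∎
    where
    open ≐-Reasoning
    open PS-Solver using (solve; _:+_; _:*_; _:-_; _:=_)
    c = constP (ι 2) ⊗ (oneP ⊖ X)
    d₀ = d m
    d₁ = d (suc m)
    d₂ = d (suc (suc m))
    d₃ = d (suc (suc (suc m)))
    d₄ = d (suc (suc (suc (suc m))))
    d₅ = d (suc (suc (suc (suc (suc m)))))

  wronskian : ∀ m → Wronskian m
  wronskian zero          = wronskian-zero
  wronskian (suc zero)    = wronskian-one
  wronskian (suc (suc m)) = wronskian-step m (wronskian m)

module ClosedForms where

  open import Data.Nat using (ℕ; zero; suc)
  open import Data.Product using (_×_; _,_)
  open import Data.Rational using (0ℚ; 1ℚ; _+_; _*_; -_)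
  open import Data.Rational.Properties
  open import Relation.Binary.PropositionalEquality

  open import Defs using (oneP; X; _⊕_; _⊖_; _⊗_; invP; a; b; abar; d)
  open PowerSeries
  open Denominators

  ClosedForm : ℕ → Set
  ClosedForm m = (a m ⊗ d m ≐ X ⊗ abar m) × (b m ⊗ (d m ⊗ d (suc m)) ≐ X)

  closedForm-zero : ClosedForm 0
  closedForm-zero = ⊗-congˡ X (≐-trans d-zero (≐-sym abar-zero)) , (begin
    X ⊗ (d 0 ⊗ d 1)    ≈⟨ ⊗-congˡ X (⊗-cong d-zero d-one) ⟩
    X ⊗ (oneP ⊗ oneP)  ≈⟨ ⊗-congˡ X (⊗-identityˡ oneP) ⟩
    X ⊗ oneP           ≈⟨ ⊗-identityʳ X ⟩
    X                  ∎)
    where open ≐-Reasoning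

  module ClosedFormStep (m : ℕ) (a⊗d≐ : a m ⊗ d m ≐ X ⊗ abar m) (b⊗dd≐ : b m ⊗ (d m ⊗ d (suc m)) ≐ X) where
    private
      a₀ = a m
      b₀ = b m
      d₀ = d m
      d₁ = d (suc m)
      d₂ = d (suc (suc m))
      d₃ = d (suc (suc (suc m)))

    a-step : a (suc m) ⊗ d₁ ≐ X ⊗ abar (suc m)
    a-step = ⊗-cancelʳ d₀ (d-at-zero≢0 m) (begin
      (a₀ ⊕ b₀) ⊗ d₁ ⊗ d₀
        ≈⟨ solve 4 (λ a b e f → (a :+ b) :* f :* e := a :* e :* f :+ b :* (e :* f)) ≐-refl a₀ b₀ d₀ d₁ ⟩
      a₀ ⊗ d₀ ⊗ d₁ ⊕ b₀ ⊗ (d₀ ⊗ d₁)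
        ≈⟨ ⊕-cong (⊗-congʳ d₁ (≐-trans a⊗d≐ (X⊗abar m))) b⊗dd≐ ⟩
      (d₀ ⊖ d₂) ⊗ d₁ ⊕ X
        ≈⟨ solve 4 (λ e f g x → (e :- g) :* f :+ x := e :* f :- (g :* f :- x)) ≐-refl d₀ d₁ d₂ X ⟩
      d₀ ⊗ d₁ ⊖ (d₂ ⊗ d₁ ⊖ X)
        ≈⟨ ⊖-congˡ (d₀ ⊗ d₁) (⊖-congʳ X (wronskian m)) ⟩
      d₀ ⊗ d₁ ⊖ (d₃ ⊗ d₀ ⊕ X ⊖ X)
        ≈⟨ solve 4 (λ e f h x → e :* f :- (h :* e :+ x :- x) := (f :- h) :* e) ≐-refl d₀ d₁ d₃ X ⟩
      (d₁ ⊖ d₃) ⊗ d₀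
        ≈⟨ ⊗-congʳ d₀ (X⊗abar (suc m)) ⟨
      X ⊗ abar (suc m) ⊗ d₀
        ∎)
      where
      open ≐-Reasoning
      open PS-Solver using (solve; _:+_; _:*_; _:-_; _:=_)

    a-at-zero : a₀ 0 ≡ 0ℚ
    a-at-zero = begin
      a₀ 0            ≡⟨ *-identityʳ (a₀ 0) ⟨
      a₀ 0 * 1ℚ       ≡⟨ cong (a₀ 0 *_) (d-at-zero m) ⟨
      a₀ 0 * d₀ 0     ≡⟨ ⊗-at-zero a₀ d₀ ⟨
      (a₀ ⊗ d₀) 0     ≡⟨ a⊗d≐ .coeff 0 ⟩
      (X ⊗ abar m) 0  ≡⟨ X⊗-at-zero (abar m) ⟩
      0ℚ              ∎
      where open ≡-Reasoning

    1-a≢0 : (oneP ⊖ a₀) 0 ≢ 0ℚ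
    1-a≢0 1-a₀≡0 = 1≢0 (trans (cong (λ x → 1ℚ + - x) (sym a-at-zero)) 1-a₀≡0)

    d₂≐[1-a]⊗d₀ : d₂ ≐ (oneP ⊖ a₀) ⊗ d₀
    d₂≐[1-a]⊗d₀ = begin
      d₂                ≈⟨ d-step m ⟩
      d₀ ⊖ X ⊗ abar m   ≈⟨ ⊖-congˡ d₀ a⊗d≐ ⟨
      d₀ ⊖ a₀ ⊗ d₀      ≈⟨ solve 2 (λ a e → e :- a :* e := (con 1ℚ :- a) :* e) ≐-refl a₀ d₀ ⟩
      (oneP ⊖ a₀) ⊗ d₀  ∎
      where
      open ≐-Reasoning
      open PS-Solver using (solve; _:*_; _:-_; _:=_; con)

    b-step : b (suc m) ⊗ (d₁ ⊗ d₂) ≐ X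
    b-step = begin
      b₀ ⊗ I ⊗ (d₁ ⊗ d₂)                  ≈⟨ ⊗-congˡ (b₀ ⊗ I) (⊗-congˡ d₁ d₂≐[1-a]⊗d₀) ⟩
      b₀ ⊗ I ⊗ (d₁ ⊗ ((oneP ⊖ a₀) ⊗ d₀))  ≈⟨ solve 5 (λ b i f q e → b :* i :* (f :* (q :* e)) := b :* (e :* f) :* (q :* i)) ≐-refl b₀ I d₁ (oneP ⊖ a₀) d₀ ⟩
      b₀ ⊗ (d₀ ⊗ d₁) ⊗ ((oneP ⊖ a₀) ⊗ I)  ≈⟨ ⊗-cong b⊗dd≐ (⊗-invP (oneP ⊖ a₀) 1-a≢0) ⟩
      X ⊗ oneP                            ≈⟨ ⊗-identityʳ X ⟩
      X                                   ∎
      where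
      open ≐-Reasoning
      open PS-Solver using (solve; _:*_; _:=_)
      I = invP (oneP ⊖ a₀)

  closedForm : ∀ m → ClosedForm m
  closedForm zero    = closedForm-zero
  closedForm (suc m) = let a⊗d≐ , b⊗dd≐ = closedForm m; open ClosedFormStep m a⊗d≐ b⊗dd≐ in a-step , b-step

module WordSums where

  open import Data.Nat as ℕ using (ℕ; zero; suc; _<_; _≤_; z≤n; s≤s)
  import Data.Nat.Properties as ℕ
  open import Data.List using (List; []; _∷_; _++_; map; concat; length; upTo; applyUpTo)
  open import Data.List.Properties using (map-cong; map-cong-local; map-applyUpTo; map-upTo)
  open import Data.List.Relation.Unary.All.Properties using (applyUpTo⁺₁)
  open import Data.Rational using (ℚ; 0ℚ; _+_; _*_)
  open import Data.Rational.Properties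
  open import Function using (_∘_)
  open import Relation.Binary.PropositionalEquality
  open import Algebra.Bundles using (CommutativeMonoid)
  open import Algebra.Properties.CommutativeSemigroup (CommutativeMonoid.commutativeSemigroup +-0-commutativeMonoid)
    using () renaming (interchange to +-interchange)

  open import Defs using (PS; ₁; ₂; Word; wordsOfLength; wordsUpTo; sumℚ; _⊕_; _⊗_)
  open PowerSeries

  ∑ : ∀ {A : Set} → List A → (A → ℚ) → ℚ
  ∑ xs f = sumℚ (map f xs)

  ∑-++ : ∀ {A : Set} (xs ys : List A) f → ∑ (xs ++ ys) f ≡ ∑ xs f + ∑ ys f
  ∑-++ []       ys f = sym (+-identityˡ (∑ ys f))
  ∑-++ (x ∷ xs) ys f = trans (cong (f x +_) (∑-++ xs ys f)) (sym (+-assoc (f x) (∑ xs f) (∑ ys f)))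

  ∑-concatMap : ∀ {A B : Set} (xs : List A) (h : A → List B) f → ∑ (concat (map h xs)) f ≡ ∑ xs (λ x → ∑ (h x) f)
  ∑-concatMap []       h f = refl
  ∑-concatMap (x ∷ xs) h f = trans (∑-++ (h x) (concat (map h xs)) f) (cong (∑ (h x) f +_) (∑-concatMap xs h f))

  ∑-cong : ∀ {A : Set} (xs : List A) {f g : A → ℚ} → (∀ x → f x ≡ g x) → ∑ xs f ≡ ∑ xs g
  ∑-cong xs f≗g = cong sumℚ (map-cong f≗g xs)

  ∑-zero : ∀ {A : Set} (xs : List A) → ∑ xs (λ _ → 0ℚ) ≡ 0ℚ
  ∑-zero []       = refl
  ∑-zero (x ∷ xs) = trans (cong (0ℚ +_) (∑-zero xs)) (+-identityˡ 0ℚ)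

  ∑-+ : ∀ {A : Set} (xs : List A) f g → ∑ xs (λ x → f x + g x) ≡ ∑ xs f + ∑ xs g
  ∑-+ []       f g = sym (+-identityˡ 0ℚ)
  ∑-+ (x ∷ xs) f g = trans (cong (f x + g x +_) (∑-+ xs f g)) (+-interchange (f x) (g x) (∑ xs f) (∑ xs g))

  ∑-*ˡ : ∀ {A : Set} (xs : List A) c f → c * ∑ xs f ≡ ∑ xs (λ x → c * f x)
  ∑-*ˡ []       c f = *-zeroʳ c
  ∑-*ˡ (x ∷ xs) c f = trans (*-distribˡ-+ c (f x) (∑ xs f)) (cong (c * f x +_) (∑-*ˡ xs c f))

  ∑-*ʳ : ∀ {A : Set} (xs : List A) c f → ∑ xs f * c ≡ ∑ xs (λ x → f x * c)
  ∑-*ʳ xs c f = trans (*-comm (∑ xs f) c) (trans (∑-*ˡ xs c f) (∑-cong xs (λ x → *-comm c (f x))))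

  ∑-swap : ∀ {A B : Set} (xs : List A) (ys : List B) (f : A → B → ℚ) →
           ∑ xs (λ x → ∑ ys (f x)) ≡ ∑ ys (λ y → ∑ xs (λ x → f x y))
  ∑-swap []       ys f = sym (∑-zero ys)
  ∑-swap (x ∷ xs) ys f = trans (cong (∑ ys (f x) +_) (∑-swap xs ys f)) (sym (∑-+ ys (f x) (λ y → ∑ xs (λ x′ → f x′ y))))

  ∑-applyUpTo-suc : ∀ k (f : ℕ → ℚ) → ∑ (applyUpTo suc k) f ≡ ∑ (upTo k) (f ∘ suc)
  ∑-applyUpTo-suc k f = cong sumℚ (trans (map-applyUpTo suc f k) (sym (map-upTo (f ∘ suc) k)))

  ∑-upTo-cong : ∀ n {f g : ℕ → ℚ} → (∀ k → k < n → f k ≡ g k) → ∑ (upTo n) f ≡ ∑ (upTo n) g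
  ∑-upTo-cong n f≡g = cong sumℚ (map-cong-local (applyUpTo⁺₁ (λ k → k) n (f≡g _)))

  sumWords : ℕ → (Word → ℚ) → ℚ
  sumWords n = ∑ (wordsUpTo n)

  ∑-wordsOfLength-suc : ∀ j F → ∑ (wordsOfLength (suc j)) F ≡ ∑ (wordsOfLength j) (λ w → F (₁ ∷ w) + F (₂ ∷ w))
  ∑-wordsOfLength-suc j F = trans (∑-concatMap (wordsOfLength j) (λ w → (₁ ∷ w) ∷ (₂ ∷ w) ∷ []) F)
    (∑-cong (wordsOfLength j) (λ w → cong (F (₁ ∷ w) +_) (+-identityʳ (F (₂ ∷ w)))))

  sumWords-zero : ∀ F → sumWords 0 F ≡ F []
  sumWords-zero F = +-identityʳ (F [])

  sumWords-suc : ∀ n F → sumWords (suc n) F ≡ F [] + sumWords n (λ w → F (₁ ∷ w) + F (₂ ∷ w))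
  sumWords-suc n F = cong (F [] +_) (begin
    ∑ (concat (map wordsOfLength (applyUpTo suc (suc n)))) F  ≡⟨ ∑-concatMap (applyUpTo suc (suc n)) wordsOfLength F ⟩
    ∑ (applyUpTo suc (suc n)) (λ j → ∑ (wordsOfLength j) F)   ≡⟨ ∑-applyUpTo-suc (suc n) (λ j → ∑ (wordsOfLength j) F) ⟩
    ∑ (upTo (suc n)) (λ j → ∑ (wordsOfLength (suc j)) F)      ≡⟨ ∑-cong (upTo (suc n)) (λ j → ∑-wordsOfLength-suc j F) ⟩
    ∑ (upTo (suc n)) (λ j → ∑ (wordsOfLength j) F′)           ≡⟨ ∑-concatMap (upTo (suc n)) wordsOfLength F′ ⟨
    sumWords n F′                                             ∎)
    where
    open ≡-Reasoning
    F′ = λ w → F (₁ ∷ w) + F (₂ ∷ w)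

  sumWords-cong : ∀ n {F G} → (∀ w → F w ≡ G w) → sumWords n F ≡ sumWords n G
  sumWords-cong n = ∑-cong (wordsUpTo n)

  sumWords-vanishing : ∀ n {F} → (∀ w → F w ≡ 0ℚ) → sumWords n F ≡ 0ℚ
  sumWords-vanishing n F≡0 = trans (sumWords-cong n F≡0) (∑-zero (wordsUpTo n))

  sumWords-truncate : ∀ {k N} F → k ≤ N → (∀ w → k < length w → F w ≡ 0ℚ) → sumWords N F ≡ sumWords k F
  sumWords-truncate {zero}  {zero}  F _ _ = refl
  sumWords-truncate {zero}  {suc N} F _ F≡0 = begin
    sumWords (suc N) F                          ≡⟨ sumWords-suc N F ⟩
    F [] + sumWords N (λ w → F (₁ ∷ w) + F (₂ ∷ w))
      ≡⟨ cong (F [] +_) (sumWords-vanishing N λ w → trans (cong₂ _+_ (F≡0 (₁ ∷ w) (s≤s z≤n)) (F≡0 (₂ ∷ w) (s≤s z≤n))) (+-identityʳ 0ℚ)) ⟩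
    F [] + 0ℚ     ≡⟨ +-identityʳ (F []) ⟩
    F []          ≡⟨ sumWords-zero F ⟨
    sumWords 0 F  ∎
    where open ≡-Reasoning
  sumWords-truncate {suc k} {suc N} F (s≤s k≤N) F≡0 = begin
    sumWords (suc N) F    ≡⟨ sumWords-suc N F ⟩
    F [] + sumWords N F′  ≡⟨ cong (F [] +_) (sumWords-truncate F′ k≤N F′≡0) ⟩
    F [] + sumWords k F′  ≡⟨ sumWords-suc k F ⟨
    sumWords (suc k) F    ∎
    where
    open ≡-Reasoning
    F′ = λ w → F (₁ ∷ w) + F (₂ ∷ w)
    F′≡0 : ∀ w → k < length w → F′ w ≡ 0ℚ
    F′≡0 w k<∣w∣ = trans (cong₂ _+_ (F≡0 (₁ ∷ w) (s≤s k<∣w∣)) (F≡0 (₂ ∷ w) (s≤s k<∣w∣))) (+-identityʳ 0ℚ)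

  -- For Summable G this is Σ_w G w: each G w vanishes below degree length w.
  seriesSum : (Word → PS) → PS
  seriesSum G n = sumWords n (λ w → G w n)

  Summable : (Word → PS) → Set
  Summable G = ∀ w → VanishesBelow (length w) (G w)

  seriesSum-cong : ∀ {G H} → (∀ w → G w ≐ H w) → seriesSum G ≐ seriesSum H
  seriesSum-cong G≐H .coeff n = sumWords-cong n (λ w → G≐H w .coeff n)

  seriesSum-⊕ : ∀ G H → seriesSum (λ w → G w ⊕ H w) ≐ seriesSum G ⊕ seriesSum H
  seriesSum-⊕ G H .coeff n = ∑-+ (wordsUpTo n) (λ w → G w n) (λ w → H w n)

  seriesSum-⊗ʳ : ∀ G h → Summable G → seriesSum (λ w → G w ⊗ h) ≐ seriesSum G ⊗ h
  seriesSum-⊗ʳ G h summable .coeff n = begin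
    sumWords n (λ w → ∑ (upTo (suc n)) (λ k → G w k * h (n ℕ.∸ k)))
      ≡⟨ ∑-swap (wordsUpTo n) (upTo (suc n)) (λ w k → G w k * h (n ℕ.∸ k)) ⟩
    ∑ (upTo (suc n)) (λ k → sumWords n (λ w → G w k * h (n ℕ.∸ k)))
      ≡⟨ ∑-upTo-cong (suc n) (λ k k≤n → trans (sym (∑-*ʳ (wordsUpTo n) (h (n ℕ.∸ k)) (λ w → G w k)))
                                               (cong (_* h (n ℕ.∸ k)) (truncate k (ℕ.≤-pred k≤n)))) ⟩
    ∑ (upTo (suc n)) (λ k → seriesSum G k * h (n ℕ.∸ k))
      ∎
    where
    open ≡-Reasoning
    truncate : ∀ k → k ≤ n → sumWords n (λ w → G w k) ≡ seriesSum G k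
    truncate k k≤n = sumWords-truncate (λ w → G w k) k≤n (λ w k<∣w∣ → summable w k k<∣w∣)

  module _ (G : Word → PS) (summable : Summable G) where
    private
      G′ : Word → PS
      G′ w = G (₁ ∷ w) ⊕ G (₂ ∷ w)

      G′-vanishes : ∀ w k → k < suc (length w) → G′ w k ≡ 0ℚ
      G′-vanishes w k k≤∣w∣ = trans (cong₂ _+_ (summable (₁ ∷ w) k k≤∣w∣) (summable (₂ ∷ w) k k≤∣w∣)) (+-identityʳ 0ℚ)

    seriesSum-uncons : seriesSum G ≐ G [] ⊕ seriesSum (λ w → G (₁ ∷ w) ⊕ G (₂ ∷ w))
    seriesSum-uncons .coeff zero = begin
      sumWords 0 (λ w → G w 0)            ≡⟨ sumWords-zero (λ w → G w 0) ⟩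
      G [] 0                              ≡⟨ +-identityʳ (G [] 0) ⟨
      G [] 0 + 0ℚ                         ≡⟨ cong (G [] 0 +_) (sumWords-vanishing 0 λ w → G′-vanishes w 0 (s≤s z≤n)) ⟨
      G [] 0 + sumWords 0 (λ w → G′ w 0)  ∎
      where open ≡-Reasoning
    seriesSum-uncons .coeff (suc n) = begin
      sumWords (suc n) (λ w → G w (suc n))            ≡⟨ sumWords-suc n (λ w → G w (suc n)) ⟩
      G [] (suc n) + sumWords n (λ w → G′ w (suc n))  ≡⟨ cong (G [] (suc n) +_) (sumWords-truncate (λ w → G′ w (suc n)) (ℕ.n≤1+n n)
                                                               (λ w n<∣w∣ → G′-vanishes w (suc n) (s≤s n<∣w∣))) ⟨
      G [] (suc n) + sumWords (suc n) (λ w → G′ w (suc n)) ∎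
      where open ≡-Reasoning

  seriesSum-⊗ˡ : ∀ G h → Summable G → seriesSum (λ w → h ⊗ G w) ≐ h ⊗ seriesSum G
  seriesSum-⊗ˡ G h summable = begin
    seriesSum (λ w → h ⊗ G w)  ≈⟨ seriesSum-cong (λ w → ⊗-comm h (G w)) ⟩
    seriesSum (λ w → G w ⊗ h)  ≈⟨ seriesSum-⊗ʳ G h summable ⟩
    seriesSum G ⊗ h            ≈⟨ ⊗-comm (seriesSum G) h ⟩
    h ⊗ seriesSum G            ∎
    where open ≐-Reasoning

module ZetaFunction where

  open import Data.Bool using (if_then_else_)
  open import Data.Nat using (_<_)
  open import Data.List using ([]; _∷_; length)
  open import Data.List.Properties using (≡-dec; ∷-injectiveʳ)
  open import Data.List.Relation.Binary.Sublist.Heterogeneous.Properties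
    using (sublist?; Sublist-[]-universal; ∷⁻¹; ∷ʳ⁻¹; length-mono-≤)
  import Data.Nat.Properties as ℕ
  open import Function.Bundles using (_⇔_; mk⇔)
  open import Relation.Binary.PropositionalEquality
  open import Relation.Nullary.Decidable using (does-⇔; dec-true; dec-false)

  open import Defs using (₁; ₂; _≤L_; 1≤1; 1≤2; 2≤2; _≤L?_; _≟L_; _≼_; ζ; δ)

  ζ-⇔ : ∀ {u w u′ w′} → u ≼ w ⇔ u′ ≼ w′ → ζ u w ≡ ζ u′ w′
  ζ-⇔ {u} {w} {u′} {w′} u≼w⇔u′≼w′ =
    cong (if_then 1 else 0) (does-⇔ u≼w⇔u′≼w′ (sublist? _≤L?_ u w) (sublist? _≤L?_ u′ w′))

  ζ-[]ˡ : ∀ w → ζ [] w ≡ 1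
  ζ-[]ˡ w = cong (if_then 1 else 0) (dec-true (sublist? _≤L?_ [] w) (Sublist-[]-universal w))

  ζ-∷-[] : ∀ c v → ζ (c ∷ v) [] ≡ 0
  ζ-∷-[] c v = cong (if_then 1 else 0) (dec-false (sublist? _≤L?_ (c ∷ v) []) (λ ()))

  ζ-longer : ∀ v w → length w < length v → ζ v w ≡ 0
  ζ-longer v w ∣w∣<∣v∣ = cong (if_then 1 else 0)
    (dec-false (sublist? _≤L?_ v w) (λ v≼w → ℕ.<⇒≱ ∣w∣<∣v∣ (length-mono-≤ v≼w)))

  ₁≤L : ∀ c → ₁ ≤L c
  ₁≤L ₁ = 1≤1
  ₁≤L ₂ = 1≤2

  ζ-₁∷ : ∀ c v w → ζ (₁ ∷ v) (c ∷ w) ≡ ζ v w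
  ζ-₁∷ c v w = sym (ζ-⇔ {v} {w} (∷⁻¹ (₁≤L c)))

  ζ-₂∷-₁∷ : ∀ v w → ζ (₂ ∷ v) (₁ ∷ w) ≡ ζ (₂ ∷ v) w
  ζ-₂∷-₁∷ v w = sym (ζ-⇔ {₂ ∷ v} {w} {₂ ∷ v} {₁ ∷ w} (∷ʳ⁻¹ (λ ())))

  ζ-₂∷-₂∷ : ∀ v w → ζ (₂ ∷ v) (₂ ∷ w) ≡ ζ v w
  ζ-₂∷-₂∷ v w = sym (ζ-⇔ {v} {w} (∷⁻¹ 2≤2))

  δ-∷-∷ : ∀ c u w → δ (c ∷ u) (c ∷ w) ≡ δ u w
  δ-∷-∷ c u w = cong (if_then 1 else 0) (does-⇔ (mk⇔ ∷-injectiveʳ (cong (c ∷_))) (≡-dec _≟L_ (c ∷ u) (c ∷ w)) (≡-dec _≟L_ u w))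

  δ-₁∷-₂∷ : ∀ u w → δ (₁ ∷ u) (₂ ∷ w) ≡ 0
  δ-₁∷-₂∷ u w = cong (if_then 1 else 0) (dec-false (≡-dec _≟L_ (₁ ∷ u) (₂ ∷ w)) (λ ()))

  δ-₂∷-₁∷ : ∀ u w → δ (₂ ∷ u) (₁ ∷ w) ≡ 0
  δ-₂∷-₁∷ u w = cong (if_then 1 else 0) (dec-false (≡-dec _≟L_ (₂ ∷ u) (₁ ∷ w)) (λ ()))

module GeneratingSeries where

  open import Data.Nat as ℕ using (ℕ; zero; suc; _<_; _≤_; _≤?_; z≤n; s≤s)
  import Data.Nat.Properties as ℕ
  open import Data.Nat.GeneralisedArithmetic using (fold; fold-+)
  open import Data.List using ([]; _∷_; length)
  open import Data.Product using (_×_; _,_; proj₁; proj₂)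
  open import Data.Rational using (ℚ; 0ℚ; 1ℚ; _+_; _*_; -_)
  open import Data.Rational.Properties using (*-zeroˡ; *-zeroʳ; *-assoc; +-identityʳ; 1≢0)
  open import Relation.Binary.PropositionalEquality
  open import Relation.Nullary using (yes; no)

  open import Defs using (PS; constP; oneP; _⊕_; ⊝_; _⊖_; _⊗_; _^ₚ_; prodP; invP; Word; ₁; ₂; count; wordsUpTo; ζ; δ; ζ^)
  open NatCast
  open PowerSeries
  open WordSums
  open ZetaFunction

  weight : PS × PS → Word → PS
  weight p []       = oneP
  weight p (₁ ∷ w) = proj₁ p ⊗ weight p w
  weight p (₂ ∷ w) = proj₂ p ⊗ weight p w

  record Admissible (p : PS × PS) : Set where
    constructor admissible
    field
      x-vanishes : VanishesBelow 1 (proj₁ p)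
      y-vanishes : VanishesBelow 1 (proj₂ p)
  open Admissible

  weight-vanishes : ∀ {p} → Admissible p → ∀ w → VanishesBelow (length w) (weight p w)
  weight-vanishes adm []       k ()
  weight-vanishes adm (₁ ∷ w) = ⊗-vanishesBelow (adm .x-vanishes) (weight-vanishes adm w)
  weight-vanishes adm (₂ ∷ w) = ⊗-vanishesBelow (adm .y-vanishes) (weight-vanishes adm w)

  weight-power : ∀ p u → weight p u ≐ (proj₁ p ^ₚ count ₁ u) ⊗ (proj₂ p ^ₚ count ₂ u)
  weight-power p []       = ≐-sym (⊗-identityˡ oneP)
  weight-power p (₁ ∷ u) = ≐-trans (⊗-congˡ (proj₁ p) (weight-power p u)) (≐-sym (⊗-assoc (proj₁ p) _ _))
  weight-power p (₂ ∷ u) = begin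
    proj₂ p ⊗ weight p u  ≈⟨ ⊗-congˡ (proj₂ p) (weight-power p u) ⟩
    proj₂ p ⊗ (A ⊗ B)     ≈⟨ solve 3 (λ y a b → y :* (a :* b) := a :* (y :* b)) ≐-refl (proj₂ p) A B ⟩
    A ⊗ (proj₂ p ⊗ B)     ∎
    where
    open ≐-Reasoning
    open PS-Solver using (solve; _:*_; _:=_)
    A = proj₁ p ^ₚ count ₁ u
    B = proj₂ p ^ₚ count ₂ u

  weightedSum : PS × PS → (Word → ℚ) → PS
  weightedSum p c = seriesSum (λ w → c w · weight p w)

  weighted-summable : ∀ {p} → Admissible p → ∀ (c : Word → ℚ) → Summable (λ w → c w · weight p w)
  weighted-summable adm c w k k<∣w∣ = trans (cong (c w *_) (weight-vanishes adm w k k<∣w∣)) (*-zeroʳ (c w))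

  weightedSum-cong : ∀ p {c c′ : Word → ℚ} → (∀ w → c w ≡ c′ w) → weightedSum p c ≐ weightedSum p c′
  weightedSum-cong p c≡c′ = seriesSum-cong (λ w → coeffwise λ n → cong (_* weight p w n) (c≡c′ w))

  weightedSum-zero : ∀ p → weightedSum p (λ _ → 0ℚ) ≐ constP 0ℚ
  weightedSum-zero p .coeff zero    = sumWords-vanishing 0 (λ w → *-zeroˡ (weight p w 0))
  weightedSum-zero p .coeff (suc n) = sumWords-vanishing (suc n) (λ w → *-zeroˡ (weight p w (suc n)))

  next : PS × PS → PS × PS
  next p = proj₁ p ⊕ proj₂ p , proj₂ p ⊗ invP (oneP ⊖ proj₁ p)

  factor : PS × PS → PS
  factor p = invP (oneP ⊖ proj₁ p ⊖ proj₂ p)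

  ζ-series : PS × PS → Word → PS
  ζ-series p v = weightedSum p (λ w → ι (ζ v w))

  module _ {p : PS × PS} (adm : Admissible p) where
    private
      x = proj₁ p
      y = proj₂ p

    weightedSum-uncons : ∀ (c : Word → ℚ) → weightedSum p c ≐
      c [] · oneP ⊕ (x ⊗ weightedSum p (λ w → c (₁ ∷ w)) ⊕ y ⊗ weightedSum p (λ w → c (₂ ∷ w)))
    weightedSum-uncons c = begin
      weightedSum p c
        ≈⟨ seriesSum-uncons (λ w → c w · weight p w) (weighted-summable adm c) ⟩
      c [] · oneP ⊕ seriesSum (λ w → c₁ w · (x ⊗ weight p w) ⊕ c₂ w · (y ⊗ weight p w))
        ≈⟨ ⊕-congˡ (c [] · oneP) (seriesSum-cong λ w → ⊕-cong (≐-sym (⊗-· (c₁ w) x (weight p w))) (≐-sym (⊗-· (c₂ w) y (weight p w)))) ⟩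
      c [] · oneP ⊕ seriesSum (λ w → x ⊗ (c₁ w · weight p w) ⊕ y ⊗ (c₂ w · weight p w))
        ≈⟨ ⊕-congˡ (c [] · oneP) (seriesSum-⊕ (λ w → x ⊗ (c₁ w · weight p w)) (λ w → y ⊗ (c₂ w · weight p w))) ⟩
      c [] · oneP ⊕ (seriesSum (λ w → x ⊗ (c₁ w · weight p w)) ⊕ seriesSum (λ w → y ⊗ (c₂ w · weight p w)))
        ≈⟨ ⊕-congˡ (c [] · oneP) (⊕-cong (seriesSum-⊗ˡ _ x (weighted-summable adm c₁)) (seriesSum-⊗ˡ _ y (weighted-summable adm c₂))) ⟩
      c [] · oneP ⊕ (x ⊗ weightedSum p c₁ ⊕ y ⊗ weightedSum p c₂)
        ∎
      where
      open ≐-Reasoning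
      c₁ c₂ : Word → ℚ
      c₁ w = c (₁ ∷ w)
      c₂ w = c (₂ ∷ w)

    weightedSum-δ : ∀ u → weightedSum p (λ w → ι (δ u w)) ≐ weight p u
    weightedSum-δ [] = begin
      weightedSum p (λ w → ι (δ [] w))
        ≈⟨ weightedSum-uncons (λ w → ι (δ [] w)) ⟩
      1ℚ · oneP ⊕ (x ⊗ weightedSum p (λ _ → 0ℚ) ⊕ y ⊗ weightedSum p (λ _ → 0ℚ))
        ≈⟨ ⊕-cong (·-identityˡ oneP) (⊕-cong (⊗-congˡ x (weightedSum-zero p)) (⊗-congˡ y (weightedSum-zero p))) ⟩
      oneP ⊕ (x ⊗ constP 0ℚ ⊕ y ⊗ constP 0ℚ)
        ≈⟨ solve 2 (λ x y → con 1ℚ :+ (x :* con 0ℚ :+ y :* con 0ℚ) := con 1ℚ) ≐-refl x y ⟩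
      oneP
        ∎
      where
      open ≐-Reasoning
      open PS-Solver using (solve; _:+_; _:*_; _:=_; con)
    weightedSum-δ (₁ ∷ u) = begin
      weightedSum p (λ w → ι (δ (₁ ∷ u) w))
        ≈⟨ weightedSum-uncons (λ w → ι (δ (₁ ∷ u) w)) ⟩
      0ℚ · oneP ⊕ (x ⊗ weightedSum p (λ w → ι (δ (₁ ∷ u) (₁ ∷ w))) ⊕ y ⊗ weightedSum p (λ w → ι (δ (₁ ∷ u) (₂ ∷ w))))
        ≈⟨ ⊕-cong (·-zeroˡ oneP) (⊕-cong (⊗-congˡ x (weightedSum-cong p λ w → cong ι (δ-∷-∷ ₁ u w)))
                                         (⊗-congˡ y (weightedSum-cong p λ w → cong ι (δ-₁∷-₂∷ u w)))) ⟩
      constP 0ℚ ⊕ (x ⊗ weightedSum p (λ w → ι (δ u w)) ⊕ y ⊗ weightedSum p (λ _ → 0ℚ))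
        ≈⟨ ⊕-congˡ (constP 0ℚ) (⊕-cong (⊗-congˡ x (weightedSum-δ u)) (⊗-congˡ y (weightedSum-zero p))) ⟩
      constP 0ℚ ⊕ (x ⊗ weight p u ⊕ y ⊗ constP 0ℚ)
        ≈⟨ solve 3 (λ x y w → con 0ℚ :+ (x :* w :+ y :* con 0ℚ) := x :* w) ≐-refl x y (weight p u) ⟩
      x ⊗ weight p u
        ∎
      where
      open ≐-Reasoning
      open PS-Solver using (solve; _:+_; _:*_; _:=_; con)
    weightedSum-δ (₂ ∷ u) = begin
      weightedSum p (λ w → ι (δ (₂ ∷ u) w))
        ≈⟨ weightedSum-uncons (λ w → ι (δ (₂ ∷ u) w)) ⟩
      0ℚ · oneP ⊕ (x ⊗ weightedSum p (λ w → ι (δ (₂ ∷ u) (₁ ∷ w))) ⊕ y ⊗ weightedSum p (λ w → ι (δ (₂ ∷ u) (₂ ∷ w))))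
        ≈⟨ ⊕-cong (·-zeroˡ oneP) (⊕-cong (⊗-congˡ x (weightedSum-cong p λ w → cong ι (δ-₂∷-₁∷ u w)))
                                         (⊗-congˡ y (weightedSum-cong p λ w → cong ι (δ-∷-∷ ₂ u w)))) ⟩
      constP 0ℚ ⊕ (x ⊗ weightedSum p (λ _ → 0ℚ) ⊕ y ⊗ weightedSum p (λ w → ι (δ u w)))
        ≈⟨ ⊕-congˡ (constP 0ℚ) (⊕-cong (⊗-congˡ x (weightedSum-zero p)) (⊗-congˡ y (weightedSum-δ u))) ⟩
      constP 0ℚ ⊕ (x ⊗ constP 0ℚ ⊕ y ⊗ weight p u)
        ≈⟨ solve 3 (λ x y w → con 0ℚ :+ (x :* con 0ℚ :+ y :* w) := y :* w) ≐-refl x y (weight p u) ⟩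
      y ⊗ weight p u
        ∎
      where
      open ≐-Reasoning
      open PS-Solver using (solve; _:+_; _:*_; _:=_; con)

    ζ-series-[] : ζ-series p [] ≐ oneP ⊕ (x ⊕ y) ⊗ ζ-series p []
    ζ-series-[] = begin
      ζ-series p []
        ≈⟨ weightedSum-uncons (λ w → ι (ζ [] w)) ⟩
      ι (ζ [] []) · oneP ⊕ (x ⊗ weightedSum p (λ w → ι (ζ [] (₁ ∷ w))) ⊕ y ⊗ weightedSum p (λ w → ι (ζ [] (₂ ∷ w))))
        ≈⟨ ⊕-cong (·-identityˡ oneP) (⊕-cong (⊗-congˡ x (weightedSum-cong p (ζ[]-tail {₁}))) (⊗-congˡ y (weightedSum-cong p (ζ[]-tail {₂})))) ⟩
      oneP ⊕ (x ⊗ ζ-series p [] ⊕ y ⊗ ζ-series p [])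
        ≈⟨ ⊕-congˡ oneP (≐-sym (⊗-distribʳ (ζ-series p []) x y)) ⟩
      oneP ⊕ (x ⊕ y) ⊗ ζ-series p []
        ∎
      where
      open ≐-Reasoning
      ζ[]-tail : ∀ {c} w → ι (ζ [] (c ∷ w)) ≡ ι (ζ [] w)
      ζ[]-tail {c} w = cong ι (trans (ζ-[]ˡ (c ∷ w)) (sym (ζ-[]ˡ w)))

    ζ-series-₁∷ : ∀ v → ζ-series p (₁ ∷ v) ≐ (x ⊕ y) ⊗ ζ-series p v
    ζ-series-₁∷ v = begin
      ζ-series p (₁ ∷ v)
        ≈⟨ weightedSum-uncons (λ w → ι (ζ (₁ ∷ v) w)) ⟩
      ι (ζ (₁ ∷ v) []) · oneP ⊕ (x ⊗ weightedSum p (λ w → ι (ζ (₁ ∷ v) (₁ ∷ w))) ⊕ y ⊗ weightedSum p (λ w → ι (ζ (₁ ∷ v) (₂ ∷ w))))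
        ≈⟨ ⊕-cong (≐-trans (≡⇒≐ (cong (λ z → ι z · oneP) (ζ-∷-[] ₁ v))) (·-zeroˡ oneP))
                  (⊕-cong (⊗-congˡ x (weightedSum-cong p λ w → cong ι (ζ-₁∷ ₁ v w)))
                          (⊗-congˡ y (weightedSum-cong p λ w → cong ι (ζ-₁∷ ₂ v w)))) ⟩
      constP 0ℚ ⊕ (x ⊗ ζ-series p v ⊕ y ⊗ ζ-series p v)
        ≈⟨ solve 3 (λ x y s → con 0ℚ :+ (x :* s :+ y :* s) := (x :+ y) :* s) ≐-refl x y (ζ-series p v) ⟩
      (x ⊕ y) ⊗ ζ-series p v
        ∎
      where
      open ≐-Reasoning
      open PS-Solver using (solve; _:+_; _:*_; _:=_; con)

    ζ-series-₂∷ : ∀ v → ζ-series p (₂ ∷ v) ≐ x ⊗ ζ-series p (₂ ∷ v) ⊕ y ⊗ ζ-series p v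
    ζ-series-₂∷ v = begin
      ζ-series p (₂ ∷ v)
        ≈⟨ weightedSum-uncons (λ w → ι (ζ (₂ ∷ v) w)) ⟩
      ι (ζ (₂ ∷ v) []) · oneP ⊕ (x ⊗ weightedSum p (λ w → ι (ζ (₂ ∷ v) (₁ ∷ w))) ⊕ y ⊗ weightedSum p (λ w → ι (ζ (₂ ∷ v) (₂ ∷ w))))
        ≈⟨ ⊕-cong (≐-trans (≡⇒≐ (cong (λ z → ι z · oneP) (ζ-∷-[] ₂ v))) (·-zeroˡ oneP))
                  (⊕-cong (⊗-congˡ x (weightedSum-cong p λ w → cong ι (ζ-₂∷-₁∷ v w)))
                          (⊗-congˡ y (weightedSum-cong p λ w → cong ι (ζ-₂∷-₂∷ v w)))) ⟩
      constP 0ℚ ⊕ (x ⊗ ζ-series p (₂ ∷ v) ⊕ y ⊗ ζ-series p v)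
        ≈⟨ solve 1 (λ s → con 0ℚ :+ s := s) ≐-refl (x ⊗ ζ-series p (₂ ∷ v) ⊕ y ⊗ ζ-series p v) ⟩
      x ⊗ ζ-series p (₂ ∷ v) ⊕ y ⊗ ζ-series p v
        ∎
      where
      open ≐-Reasoning
      open PS-Solver using (solve; _:+_; _:=_; con)

    1-x≢0 : (oneP ⊖ x) 0 ≢ 0ℚ
    1-x≢0 1-x₀≡0 = 1≢0 (trans (cong (λ z → 1ℚ + - z) (sym (adm .x-vanishes 0 (s≤s z≤n)))) 1-x₀≡0)

    1-x-y≢0 : (oneP ⊖ x ⊖ y) 0 ≢ 0ℚ
    1-x-y≢0 1-x₀-y₀≡0 = 1≢0 (trans (cong₂ (λ u v → 1ℚ + - u + - v) (sym (adm .x-vanishes 0 (s≤s z≤n))) (sym (adm .y-vanishes 0 (s≤s z≤n)))) 1-x₀-y₀≡0)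

    ζ-series-closed : ∀ v → ζ-series p v ≐ weight (next p) v ⊗ factor p
    ζ-series-closed [] = ⊗≐⇒≐⊗invP (oneP ⊖ x ⊖ y) 1-x-y≢0 (begin
      L ⊗ (oneP ⊖ x ⊖ y)                  ≈⟨ solve 3 (λ x y l → l :* (con 1ℚ :- x :- y) := l :- (x :+ y) :* l) ≐-refl x y L ⟩
      L ⊖ (x ⊕ y) ⊗ L                     ≈⟨ ⊕-congʳ (⊝ ((x ⊕ y) ⊗ L)) ζ-series-[] ⟩
      (oneP ⊕ (x ⊕ y) ⊗ L) ⊖ (x ⊕ y) ⊗ L  ≈⟨ solve 1 (λ q → (con 1ℚ :+ q) :- q := con 1ℚ) ≐-refl ((x ⊕ y) ⊗ L) ⟩
      oneP                                ∎)
      where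
      open ≐-Reasoning
      open PS-Solver using (solve; _:+_; _:*_; _:-_; _:=_; con)
      L = ζ-series p []
    ζ-series-closed (₁ ∷ v) = begin
      ζ-series p (₁ ∷ v)                        ≈⟨ ζ-series-₁∷ v ⟩
      (x ⊕ y) ⊗ ζ-series p v                    ≈⟨ ⊗-congˡ (x ⊕ y) (ζ-series-closed v) ⟩
      (x ⊕ y) ⊗ (weight (next p) v ⊗ factor p)  ≈⟨ ⊗-assoc (x ⊕ y) (weight (next p) v) (factor p) ⟨
      (x ⊕ y) ⊗ weight (next p) v ⊗ factor p    ∎
      where open ≐-Reasoning
    ζ-series-closed (₂ ∷ v) = begin
      L₂                                      ≈⟨ ⊗≐⇒≐⊗invP (oneP ⊖ x) 1-x≢0 L₂⊗[1-x]≐ ⟩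
      y ⊗ ζ-series p v ⊗ I                    ≈⟨ ⊗-congʳ I (⊗-congˡ y (ζ-series-closed v)) ⟩
      y ⊗ (weight (next p) v ⊗ factor p) ⊗ I  ≈⟨ solve 4 (λ y w g i → y :* (w :* g) :* i := y :* i :* w :* g) ≐-refl y (weight (next p) v) (factor p) I ⟩
      y ⊗ I ⊗ weight (next p) v ⊗ factor p    ∎
      where
      open ≐-Reasoning
      open PS-Solver using (solve; _:+_; _:*_; _:-_; _:=_; con)
      L₂ = ζ-series p (₂ ∷ v)
      I = invP (oneP ⊖ x)
      L₂⊗[1-x]≐ : L₂ ⊗ (oneP ⊖ x) ≐ y ⊗ ζ-series p v
      L₂⊗[1-x]≐ = begin
        L₂ ⊗ (oneP ⊖ x)                       ≈⟨ solve 2 (λ x l → l :* (con 1ℚ :- x) := l :- x :* l) ≐-refl x L₂ ⟩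
        L₂ ⊖ x ⊗ L₂                           ≈⟨ ⊕-congʳ (⊝ (x ⊗ L₂)) (ζ-series-₂∷ v) ⟩
        (x ⊗ L₂ ⊕ y ⊗ ζ-series p v) ⊖ x ⊗ L₂  ≈⟨ solve 2 (λ a b → (a :+ b) :- a := b) ≐-refl (x ⊗ L₂) (y ⊗ ζ-series p v) ⟩
        y ⊗ ζ-series p v                      ∎

  next-admissible : ∀ {p} → Admissible p → Admissible (next p)
  next-admissible adm .x-vanishes zero    z<1 = trans (cong₂ _+_ (adm .x-vanishes 0 z<1) (adm .y-vanishes 0 z<1)) (+-identityʳ 0ℚ)
  next-admissible adm .x-vanishes (suc k) (s≤s ())
  next-admissible adm .y-vanishes = ⊗-vanishesBelow {1} {0} (adm .y-vanishes) (λ _ ())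

  ζ^-series : ℕ → Word → PS × PS → PS
  ζ^-series m u p = weightedSum p (λ w → ι (ζ^ m u w))

  ι-ζ^-suc : ∀ m u w → ι (ζ^ (suc m) u w) ≡ sumWords (length w) (λ v → ι (ζ^ m u v) * ι (ζ v w))
  ι-ζ^-suc m u w = trans (ι-sum (λ v → ζ^ m u v ℕ.* ζ v w) (wordsUpTo (length w))) (sumWords-cong (length w) λ v → ι-* (ζ^ m u v) (ζ v w))

  module _ {p : PS × PS} (adm : Admissible p) (m : ℕ) (u : Word) where
    ζ^-suc-expand : ∀ n w → ι (ζ^ (suc m) u w) * weight p w n ≡ sumWords n (λ v → ι (ζ^ m u v) * ι (ζ v w) * weight p w n)
    ζ^-suc-expand n w with length w ≤? n
    ... | yes ∣w∣≤n = begin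
      ι (ζ^ (suc m) u w) * weight p w n                                    ≡⟨ cong (_* weight p w n) (ι-ζ^-suc m u w) ⟩
      sumWords (length w) (λ v → ι (ζ^ m u v) * ι (ζ v w)) * weight p w n  ≡⟨ cong (_* weight p w n) (sumWords-truncate (λ v → ι (ζ^ m u v) * ι (ζ v w)) ∣w∣≤n ζ-vanishes) ⟨
      sumWords n (λ v → ι (ζ^ m u v) * ι (ζ v w)) * weight p w n           ≡⟨ ∑-*ʳ (wordsUpTo n) (weight p w n) (λ v → ι (ζ^ m u v) * ι (ζ v w)) ⟩
      sumWords n (λ v → ι (ζ^ m u v) * ι (ζ v w) * weight p w n)           ∎
      where
      open ≡-Reasoning
      ζ-vanishes : ∀ v → length w < length v → ι (ζ^ m u v) * ι (ζ v w) ≡ 0ℚ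
      ζ-vanishes v ∣w∣<∣v∣ = trans (cong (λ z → ι (ζ^ m u v) * ι z) (ζ-longer v w ∣w∣<∣v∣)) (*-zeroʳ (ι (ζ^ m u v)))
    ... | no ∣w∣≰n = begin
      ι (ζ^ (suc m) u w) * weight p w n                              ≡⟨ cong (ι (ζ^ (suc m) u w) *_) wₙ≡0 ⟩
      ι (ζ^ (suc m) u w) * 0ℚ                                        ≡⟨ *-zeroʳ (ι (ζ^ (suc m) u w)) ⟩
      0ℚ                                                             ≡⟨ sumWords-vanishing n (λ v → trans (cong (ι (ζ^ m u v) * ι (ζ v w) *_) wₙ≡0) (*-zeroʳ (ι (ζ^ m u v) * ι (ζ v w)))) ⟨
      sumWords n (λ v → ι (ζ^ m u v) * ι (ζ v w) * weight p w n)     ∎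
      where
      open ≡-Reasoning
      wₙ≡0 : weight p w n ≡ 0ℚ
      wₙ≡0 = weight-vanishes adm w n (ℕ.≰⇒> ∣w∣≰n)

    ζ^-series-suc-expand : ζ^-series (suc m) u p ≐ seriesSum (λ v → ι (ζ^ m u v) · ζ-series p v)
    ζ^-series-suc-expand .coeff n = begin
      sumWords n (λ w → ι (ζ^ (suc m) u w) * weight p w n)
        ≡⟨ sumWords-cong n (ζ^-suc-expand n) ⟩
      sumWords n (λ w → sumWords n (λ v → ι (ζ^ m u v) * ι (ζ v w) * weight p w n))
        ≡⟨ ∑-swap (wordsUpTo n) (wordsUpTo n) (λ w v → ι (ζ^ m u v) * ι (ζ v w) * weight p w n) ⟩
      sumWords n (λ v → sumWords n (λ w → ι (ζ^ m u v) * ι (ζ v w) * weight p w n))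
        ≡⟨ sumWords-cong n (λ v → trans (sumWords-cong n λ w → *-assoc (ι (ζ^ m u v)) (ι (ζ v w)) (weight p w n)) (sym (∑-*ˡ (wordsUpTo n) (ι (ζ^ m u v)) (λ w → ι (ζ v w) * weight p w n)))) ⟩
      sumWords n (λ v → ι (ζ^ m u v) * ζ-series p v n)
        ∎
      where open ≡-Reasoning

    ζ^-series-suc : ζ^-series (suc m) u p ≐ ζ^-series m u (next p) ⊗ factor p
    ζ^-series-suc = begin
      ζ^-series (suc m) u p                                            ≈⟨ ζ^-series-suc-expand ⟩
      seriesSum (λ v → ι (ζ^ m u v) · ζ-series p v)                    ≈⟨ seriesSum-cong (λ v → ·-cong (ι (ζ^ m u v)) (ζ-series-closed adm v)) ⟩
      seriesSum (λ v → ι (ζ^ m u v) · (weight (next p) v ⊗ factor p))  ≈⟨ seriesSum-cong (λ v → ·-⊗ (ι (ζ^ m u v)) (weight (next p) v) (factor p)) ⟨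
      seriesSum (λ v → ι (ζ^ m u v) · weight (next p) v ⊗ factor p)    ≈⟨ seriesSum-⊗ʳ _ (factor p) (weighted-summable (next-admissible adm) (λ v → ι (ζ^ m u v))) ⟩
      ζ^-series m u (next p) ⊗ factor p                                ∎
      where open ≐-Reasoning

  fold-next : ∀ p m → fold (next p) next m ≡ fold p next (suc m)
  fold-next p m = trans (sym (fold-+ p next m {1})) (cong (fold p next) (ℕ.+-comm m 1))

  ζ^-series-closed : ∀ m {p} → Admissible p → ∀ u →
    ζ^-series m u p ≐ weight (fold p next m) u ⊗ prodP m (λ i → factor (fold p next i))
  ζ^-series-closed zero    adm u = ≐-trans (weightedSum-δ adm u) (≐-sym (⊗-identityʳ _))
  ζ^-series-closed (suc m) {p} adm u = begin
    ζ^-series (suc m) u p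
      ≈⟨ ζ^-series-suc adm m u ⟩
    ζ^-series m u (next p) ⊗ factor p
      ≈⟨ ⊗-congʳ (factor p) (ζ^-series-closed m (next-admissible adm) u) ⟩
    weight (fold (next p) next m) u ⊗ prodP m (λ i → factor (fold (next p) next i)) ⊗ factor p
      ≈⟨ ⊗-congʳ (factor p) (⊗-cong (≡⇒≐ (cong (λ q → weight q u) (fold-next p m)))
                                    (prodP-cong m λ i → ≡⇒≐ (cong factor (fold-next p i)))) ⟩
    W ⊗ P ⊗ factor p
      ≈⟨ ⊗-assoc W P (factor p) ⟩
    W ⊗ (P ⊗ factor p)
      ≈⟨ ⊗-congˡ W (⊗-comm P (factor p)) ⟩
    W ⊗ (factor p ⊗ P)
      ≈⟨ ⊗-congˡ W (prodP-suc m (λ i → factor (fold p next i))) ⟨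
    W ⊗ prodP (suc m) (λ i → factor (fold p next i))
      ∎
    where
    open ≐-Reasoning
    W = weight (fold p next (suc m)) u
    P = prodP m (λ i → factor (fold p next (suc i)))

open import Data.Nat using (ℕ; zero; suc; s≤s)
open import Data.Nat.GeneralisedArithmetic using (fold)
open import Data.List using ([]; _∷_)
open import Data.Product using (_×_; _,_; proj₁; proj₂)
open import Data.Rational using (ℚ; 0ℚ; _+_; _*_)
open import Data.Rational.Properties using (*-identityʳ; *-zeroʳ; +-identityʳ; +-identityˡ; *-distribʳ-+; 1≢0)
open import Relation.Binary.PropositionalEquality

open import Defs
open NatCast
open PowerSeries
open ClosedForms
open Denominators
open WordSums
open GeneratingSeries

ab≡fold : ∀ m → ab m ≡ fold (X , X) next m
ab≡fold zero    = refl
ab≡fold (suc m) = cong next (ab≡fold m)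

X,X-admissible : Admissible (X , X)
X,X-admissible = admissible X-vanishes X-vanishes
  where
  X-vanishes : VanishesBelow 1 X
  X-vanishes zero    _ = refl
  X-vanishes (suc k) (s≤s ())

sumWords-weight[X,X] : ∀ n (c : Word → ℚ) → sumWords n (λ w → c w * weight (X , X) w n) ≡ ∑ (wordsOfLength n) c
sumWords-weight[X,X] zero    c = trans (sumWords-zero (λ w → c w * weight (X , X) w 0)) (trans (*-identityʳ (c [])) (sym (+-identityʳ (c []))))
sumWords-weight[X,X] (suc n) c = begin
  sumWords (suc n) (λ w → c w * weight (X , X) w (suc n))
    ≡⟨ sumWords-suc n (λ w → c w * weight (X , X) w (suc n)) ⟩
  c [] * 0ℚ + sumWords n (λ w → c (₁ ∷ w) * (X ⊗ weight (X , X) w) (suc n) + c (₂ ∷ w) * (X ⊗ weight (X , X) w) (suc n))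
    ≡⟨ cong₂ _+_ (*-zeroʳ (c [])) (sumWords-cong n λ w → trans
         (cong₂ (λ u v → c (₁ ∷ w) * u + c (₂ ∷ w) * v) (X⊗-at-suc (weight (X , X) w) n) (X⊗-at-suc (weight (X , X) w) n))
         (sym (*-distribʳ-+ (weight (X , X) w n) (c (₁ ∷ w)) (c (₂ ∷ w))))) ⟩
  0ℚ + sumWords n (λ w → (c (₁ ∷ w) + c (₂ ∷ w)) * weight (X , X) w n)
    ≡⟨ +-identityˡ (sumWords n (λ w → (c (₁ ∷ w) + c (₂ ∷ w)) * weight (X , X) w n)) ⟩
  sumWords n (λ w → (c (₁ ∷ w) + c (₂ ∷ w)) * weight (X , X) w n)
    ≡⟨ sumWords-weight[X,X] n (λ w → c (₁ ∷ w) + c (₂ ∷ w)) ⟩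
  ∑ (wordsOfLength n) (λ w → c (₁ ∷ w) + c (₂ ∷ w))
    ≡⟨ ∑-wordsOfLength-suc n c ⟨
  ∑ (wordsOfLength (suc n)) c
    ∎
  where open ≡-Reasoning

genZ≐ζ^-series : ∀ m u → genZ m u ≐ ζ^-series m u (X , X)
genZ≐ζ^-series m u .coeff n = trans (ι-sum (ζ^ m u) (wordsOfLength n)) (sym (sumWords-weight[X,X] n (λ w → ι (ζ^ m u w))))

generating-function : ∀ u m → genZ m u ≐ (a m ^ₚ count ₁ u) ⊗ (b m ^ₚ count ₂ u) ⊗ prodP m (λ i → invP (oneP ⊖ a i ⊖ b i))
generating-function u m = begin
  genZ m u
    ≈⟨ genZ≐ζ^-series m u ⟩
  ζ^-series m u (X , X)
    ≈⟨ ζ^-series-closed m X,X-admissible u ⟩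
  weight (fold (X , X) next m) u ⊗ prodP m (λ i → factor (fold (X , X) next i))
    ≈⟨ ⊗-cong (≡⇒≐ (cong (λ q → weight q u) (sym (ab≡fold m)))) (prodP-cong m λ i → ≡⇒≐ (cong factor (sym (ab≡fold i)))) ⟩
  weight (ab m) u ⊗ prodP m (λ i → invP (oneP ⊖ a i ⊖ b i))
    ≈⟨ ⊗-congʳ (prodP m (λ i → invP (oneP ⊖ a i ⊖ b i))) (weight-power (ab m) u) ⟩
  (a m ^ₚ count ₁ u) ⊗ (b m ^ₚ count ₂ u) ⊗ prodP m (λ i → invP (oneP ⊖ a i ⊖ b i))
    ∎
  where open ≐-Reasoning

a-closed-form : ∀ m → a m ≐ X ⊗ abar m ⊗ invP (d m)
a-closed-form m = ⊗≐⇒≐⊗invP (d m) (d-at-zero≢0 m) (proj₁ (closedForm m))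

b-closed-form : ∀ m → b m ≐ X ⊗ invP (d m ⊗ d (suc m))
b-closed-form m = ⊗≐⇒≐⊗invP (d m ⊗ d (suc m)) dd₀≢0 (proj₂ (closedForm m))
  where
  dd₀≢0 : (d m ⊗ d (suc m)) 0 ≢ 0ℚ
  dd₀≢0 dd₀≡0 = 1≢0 (trans (sym (trans (⊗-at-zero (d m) (d (suc m))) (cong₂ _*_ (d-at-zero m) (d-at-zero (suc m))))) dd₀≡0)

generating-function-of-type : (u : Word) (l₁ l₂ : ℕ) → type u ≡ (l₁ , l₂) → (m : ℕ) →
  genZ m u ≈ₚ ((a m ^ₚ l₁) ⊗ (b m ^ₚ l₂) ⊗ prodP m (λ i → invP (oneP ⊖ a i ⊖ b i)))
generating-function-of-type u _ _ refl m = generating-function u m .coeff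

mainTheorem6 : ((u : Word) (l₁ l₂ : ℕ) → type u ≡ (l₁ , l₂) → (m : ℕ) →
                  genZ m u ≈ₚ ((a m ^ₚ l₁) ⊗ (b m ^ₚ l₂)
                               ⊗ prodP m (λ i → invP (oneP ⊖ a i ⊖ b i))))
               × ((m : ℕ) → a m ≈ₚ (X ⊗ abar m ⊗ invP (d m)))
               × ((m : ℕ) → b m ≈ₚ (X ⊗ invP (d m ⊗ d (suc m))))
mainTheorem6 = generating-function-of-type , (λ m → a-closed-form m .coeff) , (λ m → b-closed-form m .coeff)
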